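{- Let $w$ be an oriented maximal Wicks form, and let $w'$ be obtained from $w$ by an IH-transformation on some edge. Then $w$ and $w'$ have the same number of positive vertices and the same number of negative vertices.
   Context: An oriented Wicks form is a cyclic word $w$ over an alphabet $a_1^{\pm1},a_2^{\pm1},\dots$ such that: (1) if $a_i^{\epsilon}$ appears, then $a_i^{ -\epsilon}$ appears exactly once; (2) there is no cyclic factor $a_ia_i^{ -1}$ or $a_i^{ -1}a_i$; (3) if $a_i^{\epsilon}a_j^{\delta}$ is a cyclic factor, then $a_j^{ -\delta}a_i^{ -\epsilon}$ is not. Gluing a polygon labelled by $w$ gives a closed oriented surface (whose genus is the genus of $w$) with a graph $\Gamma$. The edges of $\Gamma$ are the letter pairs, and the vertices are the classes of identified corners between consecutive letters. The form is maximal if its length is $6(2g-1)$; then all vertices have degree $3$. Sign of a vertex $V$ with its edges $a,b,c$ oriented toward $V$: $V$ is positive if $w=ab^{ -1}\cdots bc^{ -1}\cdots ca^{ -1}\cdots$ or $w=ac^{ -1}\cdots cb^{ -1}\cdots ba^{ -1}\cdots$. It is negative if $w=ab^{ -1}\cdots ca^{ -1}\cdots bc^{ -1}\cdots$ or $w=ac^{ -1}\cdots ba^{ -1}\cdots cb^{ -1}\cdots$. IH-transformation on a letter $x$: let $axb$ and $cx^{ -1}d$ be the cyclic factors of $w$ around $x$ and $x^{ -1}$, and let $y$ be a new letter. - Type 1: $c\ne a^{ -1}$ and $d\ne b^{ -1}$. Then $d^{ -1}a^{ -1}$ and $b^{ -1}c^{ -1}$ are cyclic factors. Replace $axb\mapsto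 ab$, $cx^{ -1}d\mapsto cd$, $d^{ -1}a^{ -1}\mapsto d^{ -1}ya^{ -1}$ and $b^{ -1}c^{ -1}\mapsto b^{ -1}y^{ -1}c^{ -1}$. - Type 2a: $c=a^{ -1}$. Replace $b^{ -1}axb\mapsto b^{ -1}yab$ and $d^{ -1}a^{ -1}x^{ -1}d\mapsto d^{ -1}y^{ -1}a^{ -1}d$. - Type 2b: $d=b^{ -1}$. Replace $axba^{ -1}\mapsto abya^{ -1}$ and $cx^{ -1}b^{ -1}c^{ -1}\mapsto cb^{ -1}y^{ -1}c^{ -1}$. -}

module Defs where

open import Data.Nat using (ℕ; zero; suc; _+_; _*_; _∸_)
open import Data.Nat.DivMod using (_%_; m%n<n)
open import Data.Bool using (Bool; not; if_then_else_)
open import Data.Fin using (Fin; toℕ; fromℕ<; _<_; _≟_)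
open import Data.List using (List; []; _∷_; length; lookup; concatMap; allFin; _++_; take; drop)
open import Data.Vec using (Vec) renaming (lookup to vlookup)
open import Data.Product using (Σ; ∃; ∃-syntax; _×_; _,_; proj₁)
open import Data.Sum using (_⊎_)
open import Data.Unit using (⊤)
open import Relation.Nullary using (¬_; does)
open import Relation.Binary.PropositionalEquality using (_≡_; _≢_)
open import Relation.Binary.Construct.Closure.Equivalence using (EqClosure)

-- Letters a_i^{±1}: index i and an exponent sign (true = +1, false = -1)

Letter : Set
Letter = ℕ × Bool

inv : Letter → Letter
inv (i , s) = (i , not s)

-- A cyclic word is represented by a list (read cyclically).
Pos : List Letter → Set
Pos w = Fin (length w)

at : (w : List Letter) → Pos w → Letter
at w i = lookup w i

nxt : ∀ {n} → Fin n → Fin n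
nxt {suc n} i = fromℕ< (m%n<n (suc (toℕ i)) (suc n))

prev : ∀ {n} → Fin n → Fin n
prev {suc n} i = fromℕ< (m%n<n (toℕ i + n) (suc n))

Cond1 : List Letter → Set
Cond1 w = ∀ i → Σ (Pos w) λ j → at w j ≡ inv (at w i)
                   × (∀ k → at w k ≡ inv (at w i) → k ≡ j)

Cond2 : List Letter → Set
Cond2 w = ∀ i → at w (nxt i) ≢ inv (at w i)

Cond3 : List Letter → Set
Cond3 w = ∀ i j → ¬ (at w j ≡ inv (at w (nxt i)) × at w (nxt j) ≡ inv (at w i))

OrientedWicks : List Letter → Set
OrientedWicks w = Cond1 w × Cond2 w × Cond3 w

-- Corner k (k : Pos w) is the corner between the letters at k and nxt k.
-- Gluing: letter u at position m ends where its inverse starts, so the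
-- corner after u (corner m) is identified with the corner just before
-- u⁻¹.

CornerStep : (w : List Letter) → Pos w → Pos w → Set
CornerStep w k m = at w m ≡ inv (at w (nxt k))

SameVertex : (w : List Letter) → Pos w → Pos w → Set
SameVertex w = EqClosure (CornerStep w)

-- "the number of vertex classes satisfying P is m" (P a predicate on
-- corners, used for predicates that only depend on the vertex):
-- a list of m pairwise distinct vertices satisfying P, exhausting all.
VertexCount : (w : List Letter) → (Pos w → Set) → ℕ → Set
VertexCount w P m =
  Σ (Vec (Pos w) m) λ v →
      (∀ i → P (vlookup v i))
    × (∀ i j → SameVertex w (vlookup v i) (vlookup v j) → i ≡ j)
    × (∀ k → P k → ∃[ i ] SameVertex w k (vlookup v i))

-- Genus via Euler characteristic of the glued surface (one face):
-- V - E + 1 = 2 - 2g, with E = length/2.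
HasGenus : List Letter → ℕ → Set
HasGenus w g = Σ ℕ λ V → Σ ℕ λ E →
  VertexCount w (λ _ → ⊤) V × length w ≡ 2 * E × V + 2 * g ≡ E + 1

Maximal : List Letter → Set
Maximal w = Σ ℕ λ g → HasGenus w g × length w ≡ 6 * (2 * g ∸ 1)

CyclicOrder : ∀ {n} → Fin n → Fin n → Fin n → Set
CyclicOrder i j k = (i < j × j < k) ⊎ (j < k × k < i) ⊎ (k < i × i < j)

-- V (the vertex of corner v) is positive if w = a b⁻¹ ⋯ b c⁻¹ ⋯ c a⁻¹ ⋯
-- (the second form a c⁻¹ ⋯ c b⁻¹ ⋯ b a⁻¹ ⋯ is the first one with b, c
-- renamed), where a, b, c are the letters (edges oriented toward V)
-- at the corners i, j, k of V.
PositiveVertex : (w : List Letter) → Pos w → Set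
PositiveVertex w v = Σ (Pos w) λ i → Σ (Pos w) λ j → Σ (Pos w) λ k →
    CyclicOrder i j k
  × SameVertex w v i × SameVertex w v j × SameVertex w v k
  × at w (nxt i) ≡ inv (at w j)   -- a b⁻¹ ... b
  × at w (nxt j) ≡ inv (at w k)   -- b c⁻¹ ... c
  × at w (nxt k) ≡ inv (at w i)   -- c a⁻¹

-- negative: w = a b⁻¹ ⋯ c a⁻¹ ⋯ b c⁻¹ ⋯ (second form: rename b, c)
NegativeVertex : (w : List Letter) → Pos w → Set
NegativeVertex w v = Σ (Pos w) λ i → Σ (Pos w) λ j → Σ (Pos w) λ k →
    CyclicOrder i j k
  × SameVertex w v i × SameVertex w v j × SameVertex w v k
  × at w (nxt i) ≡ inv (at w k)   -- a b⁻¹ ... b (at k)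
  × at w (nxt j) ≡ inv (at w i)   -- c a⁻¹
  × at w (nxt k) ≡ inv (at w j)   -- b c⁻¹ ... c (at j)

NumPositive : List Letter → ℕ → Set
NumPositive w = VertexCount w (PositiveVertex w)

NumNegative : List Letter → ℕ → Set
NumNegative w = VertexCount w (NegativeVertex w)

edit : (w : List Letter) → Pos w → Pos w → Pos w → Letter → Pos w → Letter
     → List Letter
edit w p q r l₁ s l₂ = concatMap f (allFin (length w))
  where
  f : Pos w → List Letter
  f i = if does (i ≟ p) then []
        else if does (i ≟ q) then []
        else if does (i ≟ r) then l₁ ∷ at w i ∷ []
        else if does (i ≟ s) then l₂ ∷ at w i ∷ []
        else at w i ∷ []

-- equality of cyclic words: u is a rotation of v
Rotation : List Letter → List Letter → Set
Rotation u v = Σ ℕ λ n → u ≡ drop n v ++ take n v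

Fresh : List Letter → Letter → Set
Fresh w y = ∀ i → proj₁ (at w i) ≢ proj₁ y

-- IH-transformation on the letter x = at w p, where at w q = x⁻¹;
-- a = at (prev p), b = at (nxt p), c = at (prev q), d = at (nxt q).
IH : List Letter → List Letter → Set
IH w w' = Σ (Pos w) λ p → Σ (Pos w) λ q → Σ Letter λ y →
  at w q ≡ inv (at w p) × Fresh w y ×
  ( -- Type 1: c ≠ a⁻¹, d ≠ b⁻¹; y inserted before a⁻¹ (after d⁻¹),
    -- y⁻¹ before c⁻¹ (after b⁻¹)
    (at w (prev q) ≢ inv (at w (prev p)) × at w (nxt q) ≢ inv (at w (nxt p))
      × Σ (Pos w) λ r → Σ (Pos w) λ s →
          at w r ≡ inv (at w (prev p)) × at w s ≡ inv (at w (prev q))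
        × Rotation w' (edit w p q r y s (inv y)))
  ⊎ -- Type 2a: c = a⁻¹; b⁻¹axb ↦ b⁻¹yab, d⁻¹a⁻¹x⁻¹d ↦ d⁻¹y⁻¹a⁻¹d
    (at w (prev q) ≡ inv (at w (prev p))
      × Rotation w' (edit w p q (prev p) y (prev q) (inv y)))
  ⊎ -- Type 2b: d = b⁻¹; axba⁻¹ ↦ abya⁻¹, cx⁻¹b⁻¹c⁻¹ ↦ cb⁻¹y⁻¹c⁻¹
    (at w (nxt q) ≡ inv (at w (nxt p))
      × Σ (Pos w) λ r → Σ (Pos w) λ s →
          at w r ≡ inv (at w (prev p)) × at w s ≡ inv (at w (prev q))
        × Rotation w' (edit w p q r y s (inv y))))

-- In a Wicks form whose graph is trivalent the signs of the vertices are
-- determined by the length n alone: there are n/6 - 1 positive and n/6 + 1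
-- negative vertices. Let τ pair each letter with its inverse; then
-- σ k = τ (k + 1) rotates the corners around a vertex. Call k a descent if
-- σ k < k. A positive vertex has one descent among its three corners, a
-- negative vertex two, so with P positive and N negative vertices there are
-- P + 2N descents. Writing t = k + 1, a descent is a t with τ t < t - 1;
-- since τ t ≠ t - 1 these are the n/2 positions with τ t < t, plus t = 0
-- from the wrap-around. So P + 2N = n/2 + 1, and with P + N = n/3 the
-- counts follow.
--
-- A maximal oriented form is trivalent: σ has no fixed points (condition 2)
-- and no 2-cycles (condition 3), and by the Euler characteristic there are
-- n/3 vertices. An IH-transformation keeps the length and the trivalence:
-- it replaces the two vertices at the ends of x by the two vertices at the
-- ends of y and leaves all other vertices unchanged.

module Submission where

open import Data.Bool using (Bool; true; false; not; _∧_; _∨_; T; if_then_else_)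
open import Data.Bool.Properties using (not-involutive; not-¬)
open import Data.Empty using (⊥-elim)
open import Data.Fin using (Fin; zero; suc; toℕ; _<_; _≟_; punchOut; remQuot; combine; cast; inject₁; fromℕ)
open import Data.Fin.Permutation using (permutation)
open import Data.Fin.Properties as Fin
  using (toℕ-fromℕ<; toℕ-injective; toℕ<n; _<?_; <-cmp; injective⇒≤; combine-remQuot;
         toℕ-cast; cast-is-id; toℕ-inject₁; toℕ-fromℕ)
open import Data.List using (List; []; _∷_; _++_; map; length; lookup; drop; take; tabulate; allFin; concatMap)
import Data.List.Properties as List
open import Data.List.Membership.Propositional using (_∈_)
open import Data.List.Membership.Propositional.Properties using (∈-lookup; ∈-concatMap⁺; ∈-concatMap⁻; ∈-allFin)
open import Data.List.Relation.Binary.Disjoint.Propositional using (Disjoint)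
open import Data.List.Relation.Binary.Permutation.Propositional
  using (_↭_; ↭-sym; ↭-trans; ↭-reflexive; ↭⇒↭ₛ)
open import Data.List.Relation.Binary.Permutation.Propositional.Properties using (++-comm; ∈-resp-↭; ↭-length)
import Data.List.Relation.Binary.Permutation.Setoid.Properties as Permutationₛ
open import Data.List.Relation.Unary.All as All using ([]; _∷_)
import Data.List.Relation.Unary.All.Properties as All
open import Data.List.Relation.Unary.AllPairs as AllPairs using ([]; _∷_)
import Data.List.Relation.Unary.AllPairs.Properties as AllPairs
open import Data.List.Relation.Unary.Any as Any using (here; there)
import Data.List.Relation.Unary.Any.Properties as Any
open import Data.List.Relation.Unary.Unique.Propositional using (Unique)
import Data.List.Relation.Unary.Unique.Propositional.Properties as Unique
open import Data.Nat as ℕ using (ℕ; zero; suc; _+_; _*_; _∸_; NonZero)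
open import Data.Nat.DivMod using (_%_; %-distribˡ-+; m%n%n≡m%n; [m+n]%n≡m%n; m<n⇒m%n≡m; n%n≡0)
open import Data.Nat.GeneralisedArithmetic using (iterate)
import Data.Nat.Properties as ℕ
open import Data.Nat.Solver using (module +-*-Solver)
open +-*-Solver using (solve; _:+_; _:*_; _:=_; con)
open import Data.Product using (Σ; ∃; ∃-syntax; _×_; _,_; proj₁; proj₂; uncurry)
open import Data.Sum using (_⊎_; inj₁; inj₂)
open import Data.Unit using (⊤; tt)
open import Data.Vec as Vec using (Vec; []; _∷_)
import Data.Vec.Properties as Vec
open import Algebra.Properties.CommutativeMonoid.Sum ℕ.+-0-commutativeMonoid
  using (sum; sum-cong-≗; ∑-distrib-+; sum-permute; sum-replicate-zero)
open import Defs
open import Function using (_∘_; _⇔_; mk⇔)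
open Function.Equivalence using (to; from)
open import Relation.Binary.Definitions using (tri<; tri≈; tri>)
open import Relation.Binary.PropositionalEquality
open import Relation.Binary.Structures using (IsEquivalence)
import Relation.Binary.Construct.Closure.Equivalence as EqClosure
open import Relation.Nullary using (Dec; does; yes; no)
open import Relation.Nullary.Decidable using (_×-dec_; _⊎-dec_; dec-true; dec-false)
open import Relation.Unary using (Decidable)

private
  variable
    n : ℕ

inv-involutive : ∀ l → inv (inv l) ≡ l
inv-involutive (i , e) = cong (i ,_) (not-involutive e)

inv≢ : ∀ l → inv l ≢ l
inv≢ (i , e) eq = not-¬ refl (sym (cong proj₂ eq))

injective⇒surjective : ∀ {m} (f : Fin m → Fin n) → (∀ {i j} → f i ≡ f j → i ≡ j) → m ≡ n →
                       ∀ k → ∃ λ i → f i ≡ k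
injective⇒surjective {suc n} f f-injective refl k with Fin.any? (λ i → f i Fin.≟ k)
... | yes hit = hit
... | no miss = ⊥-elim (ℕ.<-irrefl refl (Fin.injective⇒≤ g-injective))
  where
  g : Fin (suc n) → Fin n
  g i = punchOut (λ fi≡k → miss (i , sym fi≡k))
  g-injective : ∀ {i j} → g i ≡ g j → i ≡ j
  g-injective {i} {j} eq =
    f-injective (Fin.punchOut-injective (λ fi≡k → miss (i , sym fi≡k)) (λ fj≡k → miss (j , sym fj≡k)) eq)

%-absorbʳ-+ : ∀ m n d .{{_ : NonZero d}} → (m + n % d) % d ≡ (m + n) % d
%-absorbʳ-+ m n d = begin
  (m + n % d) % d           ≡⟨ %-distribˡ-+ m (n % d) d ⟩
  (m % d + n % d % d) % d   ≡⟨ cong (λ x → (m % d + x) % d) (m%n%n≡m%n n d) ⟩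
  (m % d + n % d) % d       ≡⟨ %-distribˡ-+ m n d ⟨
  (m + n) % d               ∎
  where open ≡-Reasoning

toℕ-nxt : (i : Fin (suc n)) → toℕ (nxt i) ≡ suc (toℕ i) % suc n
toℕ-nxt i = toℕ-fromℕ< _

toℕ-prev : (i : Fin (suc n)) → toℕ (prev i) ≡ (toℕ i + n) % suc n
toℕ-prev i = toℕ-fromℕ< _

toℕ-prev-zero : toℕ (prev {suc n} zero) ≡ n
toℕ-prev-zero {n} = trans (toℕ-prev zero) (m<n⇒m%n≡m (ℕ.n<1+n n))

private
  suc[m+n]%[1+n] : ∀ {m} → m ℕ.< suc n → suc (m + n) % suc n ≡ m
  suc[m+n]%[1+n] {n} {m} m<1+n = begin
    suc (m + n) % suc n   ≡⟨ cong (_% suc n) (ℕ.+-suc m n) ⟨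
    (m + suc n) % suc n   ≡⟨ [m+n]%n≡m%n m (suc n) ⟩
    m % suc n             ≡⟨ m<n⇒m%n≡m m<1+n ⟩
    m                     ∎
    where open ≡-Reasoning

nxt-prev : (i : Fin n) → nxt (prev i) ≡ i
nxt-prev {suc n} i = toℕ-injective (begin
  toℕ (nxt (prev i))               ≡⟨ toℕ-nxt (prev i) ⟩
  suc (toℕ (prev i)) % suc n       ≡⟨ cong (λ x → suc x % suc n) (toℕ-prev i) ⟩
  (1 + (toℕ i + n) % suc n) % suc n ≡⟨ %-absorbʳ-+ 1 (toℕ i + n) (suc n) ⟩
  suc (toℕ i + n) % suc n          ≡⟨ suc[m+n]%[1+n] (toℕ<n i) ⟩
  toℕ i                            ∎)
  where open ≡-Reasoning

prev-nxt : (i : Fin n) → prev (nxt i) ≡ i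
prev-nxt {suc n} i = toℕ-injective (begin
  toℕ (prev (nxt i))               ≡⟨ toℕ-prev (nxt i) ⟩
  (toℕ (nxt i) + n) % suc n        ≡⟨ cong (λ x → (x + n) % suc n) (toℕ-nxt i) ⟩
  (suc (toℕ i) % suc n + n) % suc n ≡⟨ cong (_% suc n) (ℕ.+-comm (suc (toℕ i) % suc n) n) ⟩
  (n + suc (toℕ i) % suc n) % suc n ≡⟨ %-absorbʳ-+ n (suc (toℕ i)) (suc n) ⟩
  (n + suc (toℕ i)) % suc n        ≡⟨ cong (_% suc n) (ℕ.+-comm n (suc (toℕ i))) ⟩
  suc (toℕ i + n) % suc n          ≡⟨ suc[m+n]%[1+n] (toℕ<n i) ⟩
  toℕ i                            ∎)
  where open ≡-Reasoning

nxt-injective : {i j : Fin n} → nxt i ≡ nxt j → i ≡ j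
nxt-injective {i = i} {j} eq = trans (sym (prev-nxt i)) (trans (cong prev eq) (prev-nxt j))

toℕ-prev-suc : (j : Fin n) → toℕ (prev (suc j)) ≡ toℕ j
toℕ-prev-suc {n} j = trans (toℕ-prev (suc j)) (suc[m+n]%[1+n] (ℕ.m<n⇒m<1+n (toℕ<n j)))

prev-injective : {i j : Fin n} → prev i ≡ prev j → i ≡ j
prev-injective {i = i} {j} eq = trans (sym (nxt-prev i)) (trans (cong nxt eq) (nxt-prev j))

nxt≢ : {i j : Fin n} → i ≢ j → nxt i ≢ i
nxt≢ {suc n} {i} {j} i≢j eq with ℕ.m<1+n⇒m<n∨m≡n (toℕ<n i)
... | inj₁ i<n = ℕ.1+n≢n (begin
  suc (toℕ i)             ≡⟨ m<n⇒m%n≡m (ℕ.s≤s i<n) ⟨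
  suc (toℕ i) % suc n     ≡⟨ toℕ-nxt i ⟨
  toℕ (nxt i)             ≡⟨ cong toℕ eq ⟩
  toℕ i                   ∎)
  where open ≡-Reasoning
... | inj₂ i≡n = i≢j (toℕ-injective (trans i≡0 (sym j≡0)))
  where
  i≡0 : toℕ i ≡ 0
  i≡0 = begin
    toℕ i                 ≡⟨ cong toℕ eq ⟨
    toℕ (nxt i)           ≡⟨ toℕ-nxt i ⟩
    suc (toℕ i) % suc n   ≡⟨ cong (λ x → suc x % suc n) i≡n ⟩
    suc n % suc n         ≡⟨ n%n≡0 (suc n) ⟩
    0                     ∎
    where open ≡-Reasoning
  j≡0 : toℕ j ≡ 0
  j≡0 = ℕ.n<1⇒n≡0 (subst (λ m → toℕ j ℕ.< suc m) (trans (sym i≡n) i≡0) (toℕ<n j))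

-- Counting positions

⟦_⟧ : Bool → ℕ
⟦ true ⟧  = 1
⟦ false ⟧ = 0

does⇒ : ∀ {P : Set} (P? : Dec P) → does P? ≡ true → P
does⇒ (yes p) _ = p

one-of-three : ∀ {x y z} → ⟦ x ⟧ + ⟦ y ⟧ + ⟦ z ⟧ ≡ 1 → x ≡ true ⊎ y ≡ true ⊎ z ≡ true
one-of-three {true}              _ = inj₁ refl
one-of-three {false} {true}      _ = inj₂ (inj₁ refl)
one-of-three {false} {false} {true} _ = inj₂ (inj₂ refl)

∧-one-of-three : ∀ b {x y z} → ⟦ x ⟧ + ⟦ y ⟧ + ⟦ z ⟧ ≡ 1 →
                 ⟦ b ∧ x ⟧ + ⟦ b ∧ y ⟧ + ⟦ b ∧ z ⟧ ≡ ⟦ b ⟧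
∧-one-of-three true  one = one
∧-one-of-three false _   = refl

_<ᵇ_ : Fin n → Fin n → Bool
i <ᵇ j = does (i <? j)

sum-reindex : (f : Fin n → ℕ) (π ρ : Fin n → Fin n) →
              (∀ i → π (ρ i) ≡ i) → (∀ i → ρ (π i) ≡ i) → sum (f ∘ π) ≡ sum f
sum-reindex f π ρ πρ ρπ = sym (sum-permute f (permutation π ρ πρ ρπ))

sum-const-1 : ∀ n → sum {n} (λ _ → 1) ≡ n
sum-const-1 zero    = refl
sum-const-1 (suc n) = cong suc (sum-const-1 n)

<ᵇ-flip : {i j : Fin n} → i ≢ j → j <ᵇ i ≡ not (i <ᵇ j)
<ᵇ-flip {i = i} {j} i≢j with <-cmp i j
... | tri< i<j _ j≮i = trans (dec-false (j <? i) j≮i) (cong not (sym (dec-true (i <? j) i<j)))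
... | tri≈ _ i≡j _   = ⊥-elim (i≢j i≡j)
... | tri> i≮j _ j<i = trans (dec-true (j <? i) j<i) (cong not (sym (dec-false (i <? j) i≮j)))

sum-<ᵇ-involution : (τ : Fin n → Fin n) → (∀ t → τ (τ t) ≡ t) → (∀ t → τ t ≢ t) →
                    sum (λ t → ⟦ τ t <ᵇ t ⟧) + sum (λ t → ⟦ τ t <ᵇ t ⟧) ≡ n
sum-<ᵇ-involution {n} τ ττ τ≢ = begin
  sum (λ t → ⟦ τ t <ᵇ t ⟧) + sum (λ t → ⟦ τ t <ᵇ t ⟧)
    ≡⟨ cong (sum (λ t → ⟦ τ t <ᵇ t ⟧) +_) (sum-reindex (λ t → ⟦ τ t <ᵇ t ⟧) τ τ ττ ττ) ⟨
  sum (λ t → ⟦ τ t <ᵇ t ⟧) + sum (λ t → ⟦ τ (τ t) <ᵇ τ t ⟧)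
    ≡⟨ ∑-distrib-+ (λ t → ⟦ τ t <ᵇ t ⟧) (λ t → ⟦ τ (τ t) <ᵇ τ t ⟧) ⟨
  sum (λ t → ⟦ τ t <ᵇ t ⟧ + ⟦ τ (τ t) <ᵇ τ t ⟧)
    ≡⟨ sum-cong-≗ exactly-one ⟩
  sum {n} (λ _ → 1)
    ≡⟨ sum-const-1 n ⟩
  n ∎
  where
  open ≡-Reasoning
  exactly-one : ∀ t → ⟦ τ t <ᵇ t ⟧ + ⟦ τ (τ t) <ᵇ τ t ⟧ ≡ 1
  exactly-one t rewrite ττ t | <ᵇ-flip (τ≢ t) with τ t <ᵇ t
  ... | true  = refl
  ... | false = refl

private
  <ᵇ-suc : ∀ {x y} → x ≢ y → does (x ℕ.<? suc y) ≡ does (x ℕ.<? y)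
  <ᵇ-suc {x} {y} x≢y with x ℕ.<? y
  ... | yes x<y = trans (dec-true (x ℕ.<? suc y) (ℕ.m<n⇒m<1+n x<y)) (sym (dec-true (x ℕ.<? y) x<y))
  ... | no x≮y  = trans (dec-false (x ℕ.<? suc y) (λ x<1+y → x≮y (ℕ.≤∧≢⇒< (ℕ.s≤s⁻¹ x<1+y) x≢y)))
                        (sym (dec-false (x ℕ.<? y) x≮y))

sum-<ᵇ-prev : Fin n → (f : Fin n → Fin n) → (∀ t → f t ≢ prev t) →
              sum (λ t → ⟦ f t <ᵇ prev t ⟧) ≡ 1 + sum (λ t → ⟦ f t <ᵇ t ⟧)
sum-<ᵇ-prev {suc n} _ f f≢prev = cong₂ _+_ at-zero (sum-cong-≗ at-suc)
  where
  at-zero : ⟦ f zero <ᵇ prev zero ⟧ ≡ 1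
  at-zero = cong ⟦_⟧ (dec-true (f zero <? prev zero) (ℕ.≤∧≢⇒<
    (subst (toℕ (f zero) ℕ.≤_) (sym toℕ-prev-zero) (ℕ.s≤s⁻¹ (toℕ<n (f zero))))
    (λ eq → f≢prev zero (toℕ-injective eq))))
  at-suc : ∀ j → ⟦ f (suc j) <ᵇ prev (suc j) ⟧ ≡ ⟦ f (suc j) <ᵇ suc j ⟧
  at-suc j = cong ⟦_⟧ (begin
    does (toℕ (f (suc j)) ℕ.<? toℕ (prev (suc j)))
      ≡⟨ cong (λ y → does (toℕ (f (suc j)) ℕ.<? y)) (toℕ-prev-suc j) ⟩
    does (toℕ (f (suc j)) ℕ.<? toℕ j)
      ≡⟨ <ᵇ-suc fj≢j ⟨
    does (toℕ (f (suc j)) ℕ.<? suc (toℕ j)) ∎)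
    where
    open ≡-Reasoning
    fj≢j : toℕ (f (suc j)) ≢ toℕ j
    fj≢j eq = f≢prev (suc j) (toℕ-injective (trans eq (sym (toℕ-prev-suc j))))

∑-distrib-+₃ : (f g h : Fin n → ℕ) → sum (λ i → f i + g i + h i) ≡ sum f + sum g + sum h
∑-distrib-+₃ f g h = trans (∑-distrib-+ (λ i → f i + g i) h) (cong (_+ sum h) (∑-distrib-+ f g))

sum-≟ : (x : Fin n) → sum (λ i → ⟦ does (i Fin.≟ x) ⟧) ≡ 1
sum-≟ {suc n} zero    = cong suc (sum-replicate-zero n)
sum-≟ {suc n} (suc x) = sum-≟ x

sum-orbit₃ : (σ : Fin n → Fin n) → (∀ k → σ (σ (σ k)) ≡ k) → (f : Fin n → ℕ) →
             sum (λ k → f k + f (σ k) + f (σ (σ k))) ≡ sum f + sum f + sum f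
sum-orbit₃ σ σ³ f = begin
  sum (λ k → f k + f (σ k) + f (σ (σ k)))
    ≡⟨ ∑-distrib-+₃ f (f ∘ σ) (f ∘ σ ∘ σ) ⟩
  sum f + sum (f ∘ σ) + sum (f ∘ σ ∘ σ)
    ≡⟨ cong₂ (λ x y → sum f + x + y) (sum-reindex f σ (σ ∘ σ) σ³ σ³)
                                     (sum-reindex f (σ ∘ σ) σ σ³ σ³) ⟩
  sum f + sum f + sum f ∎
  where open ≡-Reasoning

enumerate : (d : Fin n → Bool) → Vec (Fin n) (sum (⟦_⟧ ∘ d))
enumerate {zero}  d = []
enumerate {suc n} d with d zero
... | true  = zero ∷ Vec.map suc (enumerate (d ∘ suc))
... | false = Vec.map suc (enumerate (d ∘ suc))

enumerate-sound : (d : Fin n → Bool) (i : Fin (sum (⟦_⟧ ∘ d))) → d (Vec.lookup (enumerate d) i) ≡ true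
enumerate-sound {suc n} d i with d zero in d₀
enumerate-sound {suc n} d zero    | true  = d₀
enumerate-sound {suc n} d (suc i) | true  =
  subst (λ k → d k ≡ true) (sym (Vec.lookup-map i suc (enumerate (d ∘ suc)))) (enumerate-sound (d ∘ suc) i)
enumerate-sound {suc n} d i       | false =
  subst (λ k → d k ≡ true) (sym (Vec.lookup-map i suc (enumerate (d ∘ suc)))) (enumerate-sound (d ∘ suc) i)

enumerate-complete : (d : Fin n → Bool) (k : Fin n) → d k ≡ true → ∃ λ i → Vec.lookup (enumerate d) i ≡ k
enumerate-complete {suc n} d k dk with d zero in d₀
enumerate-complete {suc n} d zero    dk | true  = zero , refl
enumerate-complete {suc n} d zero    dk | false with () ← trans (sym d₀) dk
enumerate-complete {suc n} d (suc k) dk | true  with i , eq ← enumerate-complete (d ∘ suc) k dk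
  = suc i , trans (Vec.lookup-map i suc (enumerate (d ∘ suc))) (cong suc eq)
enumerate-complete {suc n} d (suc k) dk | false with i , eq ← enumerate-complete (d ∘ suc) k dk
  = i , trans (Vec.lookup-map i suc (enumerate (d ∘ suc))) (cong suc eq)

private
  lookup-map-suc-injective : ∀ {m} (v : Vec (Fin n) m) {i j} →
                             Vec.lookup (Vec.map suc v) i ≡ Vec.lookup (Vec.map suc v) j →
                             Vec.lookup v i ≡ Vec.lookup v j
  lookup-map-suc-injective v {i} {j} eq =
    Fin.suc-injective (trans (sym (Vec.lookup-map i suc v)) (trans eq (Vec.lookup-map j suc v)))

enumerate-injective : (d : Fin n → Bool) {i j : Fin (sum (⟦_⟧ ∘ d))} →
                      Vec.lookup (enumerate d) i ≡ Vec.lookup (enumerate d) j → i ≡ j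
enumerate-injective {suc n} d {i} {j} eq with d zero
enumerate-injective {suc n} d {zero}  {zero}  eq | true = refl
enumerate-injective {suc n} d {zero}  {suc j} eq | true
  with () ← trans eq (Vec.lookup-map j suc (enumerate (d ∘ suc)))
enumerate-injective {suc n} d {suc i} {zero}  eq | true
  with () ← trans (sym eq) (Vec.lookup-map i suc (enumerate (d ∘ suc)))
enumerate-injective {suc n} d {suc i} {suc j} eq | true  =
  cong suc (enumerate-injective (d ∘ suc) (lookup-map-suc-injective (enumerate (d ∘ suc)) eq))
enumerate-injective {suc n} d {i}     {j}     eq | false =
  enumerate-injective (d ∘ suc) (lookup-map-suc-injective (enumerate (d ∘ suc)) eq)

cyclicOrder? : (i j k : Fin n) → Dec (CyclicOrder i j k)
cyclicOrder? i j k = ((i <? j) ×-dec (j <? k)) ⊎-dec ((j <? k) ×-dec (k <? i)) ⊎-dec ((k <? i) ×-dec (i <? j))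

cyclicOrder-rotate : {i j k : Fin n} → CyclicOrder i j k → CyclicOrder j k i
cyclicOrder-rotate (inj₁ o)        = inj₂ (inj₂ o)
cyclicOrder-rotate (inj₂ (inj₁ o)) = inj₁ o
cyclicOrder-rotate (inj₂ (inj₂ o)) = inj₂ (inj₁ o)

<ᵇ⇒< : {i j : Fin n} → i <ᵇ j ≡ true → i < j
<ᵇ⇒< {i = i} {j} eq = ℕ.<ᵇ⇒< (toℕ i) (toℕ j) (subst T (sym eq) _)

<ᵇ-trans : {i j k : Fin n} → i <ᵇ j ≡ true → j <ᵇ k ≡ true → i <ᵇ k ≡ true
<ᵇ-trans {i = i} {j} {k} i<j j<k = dec-true (i <? k) (Fin.<-trans (<ᵇ⇒< i<j) (<ᵇ⇒< j<k))

private
  -- x = [a < b], y = [b < c], z = [a < c] for distinct a, b, c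
  Consistent : Bool → Bool → Bool → Set
  Consistent x y z = (x ≡ true → y ≡ true → z ≡ true) × (x ≡ false → y ≡ false → z ≡ false)

  consistent : {a b c : Fin n} → a ≢ b → b ≢ c → a ≢ c → Consistent (a <ᵇ b) (b <ᵇ c) (a <ᵇ c)
  consistent {a = a} {b} {c} a≢b b≢c a≢c = <ᵇ-trans {i = a} {b} {c} , λ a≮b b≮c →
    trans (<ᵇ-flip (a≢c ∘ sym)) (cong not (<ᵇ-trans {i = c} {b} {a}
      (trans (<ᵇ-flip b≢c) (cong not b≮c)) (trans (<ᵇ-flip a≢b) (cong not a≮b))))

  in-order reversed : Bool → Bool → Bool → Bool
  in-order x y z = (x ∧ y) ∨ (y ∧ not z) ∨ (not z ∧ x)
  reversed x y z = (z ∧ not y) ∨ (not y ∧ not x) ∨ (not x ∧ z)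

  Orientation : Bool → Bool → Bool → Set
  Orientation x y z =
      ⟦ in-order x y z ⟧ + ⟦ reversed x y z ⟧ ≡ 1
    × ⟦ not x ⟧ + ⟦ not y ⟧ + ⟦ z ⟧ ≡ ⟦ in-order x y z ⟧ + ⟦ reversed x y z ⟧ + ⟦ reversed x y z ⟧
    × ⟦ x ∧ z ⟧ + ⟦ y ∧ not x ⟧ + ⟦ not z ∧ not y ⟧ ≡ 1

  orientation : ∀ x y z → Consistent x y z → Orientation x y z
  orientation true  true  true  _ = refl , refl , refl
  orientation true  true  false (t , _) with () ← t refl refl
  orientation true  false true  _ = refl , refl , refl
  orientation true  false false _ = refl , refl , refl
  orientation false true  true  _ = refl , refl , refl
  orientation false true  false _ = refl , refl , refl
  orientation false false true  (_ , f) with () ← f refl refl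
  orientation false false false _ = refl , refl , refl

module _ {a b c : Fin n} (a≢b : a ≢ b) (b≢c : b ≢ c) (a≢c : a ≢ c) where

  private
    orientation-abc : Orientation (a <ᵇ b) (b <ᵇ c) (a <ᵇ c)
    orientation-abc = orientation (a <ᵇ b) (b <ᵇ c) (a <ᵇ c) (consistent a≢b b≢c a≢c)

  orientation-unique : ⟦ does (cyclicOrder? a b c) ⟧ + ⟦ does (cyclicOrder? a c b) ⟧ ≡ 1
  orientation-unique rewrite <ᵇ-flip a≢b | <ᵇ-flip b≢c | <ᵇ-flip a≢c = proj₁ orientation-abc

  descents-orientation :
    ⟦ b <ᵇ a ⟧ + ⟦ c <ᵇ b ⟧ + ⟦ a <ᵇ c ⟧
      ≡ ⟦ does (cyclicOrder? a b c) ⟧ + ⟦ does (cyclicOrder? a c b) ⟧ + ⟦ does (cyclicOrder? a c b) ⟧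
  descents-orientation rewrite <ᵇ-flip a≢b | <ᵇ-flip b≢c | <ᵇ-flip a≢c = proj₁ (proj₂ orientation-abc)

  minimum-unique : ⟦ a <ᵇ b ∧ a <ᵇ c ⟧ + ⟦ b <ᵇ c ∧ b <ᵇ a ⟧ + ⟦ c <ᵇ a ∧ c <ᵇ b ⟧ ≡ 1
  minimum-unique rewrite <ᵇ-flip a≢b | <ᵇ-flip b≢c | <ᵇ-flip a≢c = proj₂ (proj₂ orientation-abc)

sign-count-arithmetic : ∀ {n h d p q mp mq} →
  h + h ≡ n → d ≡ 1 + h → p + q ≡ n → d + d + d ≡ p + q + q →
  mp + mp + mp ≡ p → mq + mq + mq ≡ q →
  6 * mp + 6 ≡ n × 6 * mq ≡ n + 6
sign-count-arithmetic {n} {h} {d} {p} {q} {mp} {mq} 2h≡n d≡1+h p+q≡n 3d≡p+2q 3mp≡p 3mq≡q =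
  6mp+6≡n , 6mq≡n+6
  where
  open ≡-Reasoning
  q≡3+h : q ≡ 3 + h
  q≡3+h = ℕ.+-cancelˡ-≡ (h + h) q (3 + h) (begin
    h + h + q                  ≡⟨ cong (_+ q) (trans 2h≡n (sym p+q≡n)) ⟩
    p + q + q                  ≡⟨ 3d≡p+2q ⟨
    d + d + d                  ≡⟨ cong (λ x → x + x + x) d≡1+h ⟩
    (1 + h) + (1 + h) + (1 + h) ≡⟨ solve 1 (λ h → (con 1 :+ h) :+ (con 1 :+ h) :+ (con 1 :+ h)
                                                   := h :+ h :+ (con 3 :+ h)) refl h ⟩
    h + h + (3 + h)            ∎)
  p+3≡h : p + 3 ≡ h
  p+3≡h = ℕ.+-cancelʳ-≡ h (p + 3) h (begin
    p + 3 + h                  ≡⟨ ℕ.+-assoc p 3 h ⟩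
    p + (3 + h)                ≡⟨ cong (p +_) q≡3+h ⟨
    p + q                      ≡⟨ trans p+q≡n (sym 2h≡n) ⟩
    h + h                      ∎)
  6mp+6≡n : 6 * mp + 6 ≡ n
  6mp+6≡n = begin
    6 * mp + 6                              ≡⟨ solve 1 (λ m → con 6 :* m :+ con 6
                                                          := (m :+ m :+ m :+ con 3) :+ (m :+ m :+ m :+ con 3)) refl mp ⟩
    (mp + mp + mp + 3) + (mp + mp + mp + 3) ≡⟨ cong (λ x → (x + 3) + (x + 3)) 3mp≡p ⟩
    (p + 3) + (p + 3)                       ≡⟨ cong (λ x → x + x) p+3≡h ⟩
    h + h                                   ≡⟨ 2h≡n ⟩
    n                                       ∎
  6mq≡n+6 : 6 * mq ≡ n + 6
  6mq≡n+6 = begin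
    6 * mq                          ≡⟨ solve 1 (λ m → con 6 :* m := (m :+ m :+ m) :+ (m :+ m :+ m)) refl mq ⟩
    (mq + mq + mq) + (mq + mq + mq) ≡⟨ cong (λ x → x + x) (trans 3mq≡q q≡3+h) ⟩
    (3 + h) + (3 + h)               ≡⟨ solve 1 (λ h → (con 3 :+ h) :+ (con 3 :+ h) := h :+ h :+ con 6) refl h ⟩
    h + h + 6                       ≡⟨ cong (_+ 6) 2h≡n ⟩
    n + 6                           ∎

maximal-arithmetic : ∀ {n g V E} → 0 ℕ.< n → n ≡ 2 * E → V + 2 * g ≡ E + 1 → n ≡ 6 * (2 * g ∸ 1) →
                     V * 3 ≡ n
maximal-arithmetic {g = zero}  0<n _ _ refl = ⊥-elim (ℕ.<-irrefl refl 0<n)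
maximal-arithmetic {n} {suc g} {V} {E} _ n≡2E euler n≡ = begin
  V * 3            ≡⟨ cong (_* 3) V≡4g+2 ⟩
  (4 * g + 2) * 3  ≡⟨ solve 1 (λ g → (con 4 :* g :+ con 2) :* con 3 := con 12 :* g :+ con 6) refl g ⟩
  12 * g + 6       ≡⟨ n≡12g+6 ⟨
  n                ∎
  where
  open ≡-Reasoning
  n≡12g+6 : n ≡ 12 * g + 6
  n≡12g+6 = trans n≡ (trans (cong (6 *_) (ℕ.+-suc g (g + 0)))
    (solve 1 (λ g → con 6 :* (con 1 :+ (g :+ (g :+ con 0))) := con 12 :* g :+ con 6) refl g))
  E≡6g+3 : E ≡ 6 * g + 3
  E≡6g+3 = ℕ.*-cancelˡ-≡ E (6 * g + 3) 2 (trans (sym n≡2E) (trans n≡12g+6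
    (solve 1 (λ g → con 12 :* g :+ con 6 := con 2 :* (con 6 :* g :+ con 3)) refl g)))
  V≡4g+2 : V ≡ 4 * g + 2
  V≡4g+2 = ℕ.+-cancelʳ-≡ (2 * suc g) V (4 * g + 2) (trans euler (trans (cong (_+ 1) E≡6g+3)
    (solve 1 (λ g → con 6 :* g :+ con 3 :+ con 1 := con 4 :* g :+ con 2 :+ con 2 :* (con 1 :+ g)) refl g)))

module _ {w : List Letter} where

  VertexCount-≤ : ∀ {P m m′} → VertexCount w P m → VertexCount w P m′ → m ℕ.≤ m′
  VertexCount-≤ {P} {m} {m′} (v , Pv , distinct , _) (v′ , _ , _ , exhaust′) = injective⇒≤ injective
    where
    f : Fin m → Fin m′
    f i = proj₁ (exhaust′ (Vec.lookup v i) (Pv i))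
    injective : ∀ {i j} → f i ≡ f j → i ≡ j
    injective {i} {j} eq = distinct i j (EqClosure.transitive _ (proj₂ (exhaust′ _ (Pv i)))
      (subst (λ k → SameVertex w (Vec.lookup v′ k) (Vec.lookup v j)) (sym eq)
             (EqClosure.symmetric _ (proj₂ (exhaust′ _ (Pv j))))))

  VertexCount-unique : ∀ {P m m′} → VertexCount w P m → VertexCount w P m′ → m ≡ m′
  VertexCount-unique c c′ = ℕ.≤-antisym (VertexCount-≤ c c′) (VertexCount-≤ c′ c)

  VertexCount-resp : ∀ {P Q : Pos w → Set} {m} → (∀ k → P k ⇔ Q k) → VertexCount w P m → VertexCount w Q m
  VertexCount-resp P⇔Q (v , Pv , distinct , exhaust) =
    v , (λ i → to (P⇔Q _) (Pv i)) , distinct , (λ k Qk → exhaust k (from (P⇔Q k) Qk))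

-- The corner permutation of a word

module Corners (u : List Letter) (c1 : Cond1 u) (c2 : Cond2 u) where

  τ : Pos u → Pos u
  τ i = proj₁ (c1 i)

  τ-at : ∀ i → at u (τ i) ≡ inv (at u i)
  τ-at i = proj₁ (proj₂ (c1 i))

  τ-unique : ∀ i {k} → at u k ≡ inv (at u i) → k ≡ τ i
  τ-unique i = proj₂ (proj₂ (c1 i)) _

  τ-involutive : ∀ i → τ (τ i) ≡ i
  τ-involutive i = sym (τ-unique (τ i) (sym (trans (cong inv (τ-at i)) (inv-involutive _))))

  τ-injective : ∀ {i j} → τ i ≡ τ j → i ≡ j
  τ-injective {i} {j} eq = trans (sym (τ-involutive i)) (trans (cong τ eq) (τ-involutive j))

  at-injective : ∀ {i j} → at u i ≡ at u j → i ≡ j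
  at-injective {i} {j} eq = sym (τ-injective (τ-unique i (trans (τ-at j) (cong inv (sym eq)))))

  τ≢ : ∀ i → τ i ≢ i
  τ≢ i eq = inv≢ (at u i) (trans (sym (τ-at i)) (cong (at u) eq))

  τ≢prev : ∀ i → τ i ≢ prev i
  τ≢prev i eq = c2 (prev i) (trans (cong (at u) (nxt-prev i)) (trans (sym (inv-involutive _))
    (cong inv (trans (sym (τ-at i)) (cong (at u) eq)))))

  nxt≢τ : ∀ i → nxt i ≢ τ i
  nxt≢τ i eq = c2 i (trans (cong (at u) eq) (τ-at i))

  -- σ rotates the corners around a vertex of Γ
  σ : Pos u → Pos u
  σ k = τ (nxt k)

  σ-step : ∀ k → CornerStep u k (σ k)
  σ-step k = τ-at (nxt k)

  step⇒σ : ∀ {k m} → CornerStep u k m → m ≡ σ k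
  step⇒σ {k} = τ-unique (nxt k)

  σ-step⁻¹ : ∀ {k m} → at u (nxt k) ≡ inv (at u m) → m ≡ σ k
  σ-step⁻¹ {k} eq = step⇒σ (trans (sym (inv-involutive _)) (cong inv (sym eq)))

  at-nxt : ∀ k → at u (nxt k) ≡ inv (at u (σ k))
  at-nxt k = trans (sym (inv-involutive _)) (cong inv (sym (σ-step k)))

  nxt≡τσ : ∀ k → nxt k ≡ τ (σ k)
  nxt≡τσ k = sym (τ-involutive (nxt k))

  σ-injective : ∀ {k l} → σ k ≡ σ l → k ≡ l
  σ-injective eq = nxt-injective (τ-injective eq)

  σ≢ : ∀ k → σ k ≢ k
  σ≢ k eq = c2 k (trans (sym (inv-involutive _)) (cong inv (trans (sym (σ-step k)) (cong (at u) eq))))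

  sameVertex-σ : ∀ k → SameVertex u k (σ k)
  sameVertex-σ k = EqClosure.return (σ-step k)

  Trivalent : Set
  Trivalent = ∀ k → σ (σ (σ k)) ≡ k

  module OfTrivalent (σ³ : Trivalent) where

    σσ≢ : ∀ k → σ (σ k) ≢ k
    σσ≢ k eq = σ≢ k (trans (cong σ (sym eq)) (σ³ k))

    InOrbit : Pos u → Pos u → Set
    InOrbit a b = b ≡ a ⊎ b ≡ σ a ⊎ b ≡ σ (σ a)

    inOrbit-σ : ∀ {a b} → InOrbit a b → InOrbit a (σ b)
    inOrbit-σ     (inj₁ refl)        = inj₂ (inj₁ refl)
    inOrbit-σ     (inj₂ (inj₁ refl)) = inj₂ (inj₂ refl)
    inOrbit-σ {a} (inj₂ (inj₂ refl)) = inj₁ (σ³ a)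

    inOrbit-isEquivalence : IsEquivalence InOrbit
    inOrbit-isEquivalence = record { refl = inj₁ refl ; sym = symmetric ; trans = transitive }
      where
      symmetric : ∀ {a b} → InOrbit a b → InOrbit b a
      symmetric     (inj₁ refl)        = inj₁ refl
      symmetric {a} (inj₂ (inj₁ refl)) = inj₂ (inj₂ (sym (σ³ a)))
      symmetric {a} (inj₂ (inj₂ refl)) = inj₂ (inj₁ (sym (σ³ a)))
      transitive : ∀ {a b c} → InOrbit a b → InOrbit b c → InOrbit a c
      transitive ab (inj₁ refl)        = ab
      transitive ab (inj₂ (inj₁ refl)) = inOrbit-σ ab
      transitive ab (inj₂ (inj₂ refl)) = inOrbit-σ (inOrbit-σ ab)

    inOrbit-sym : ∀ {a b} → InOrbit a b → InOrbit b a
    inOrbit-sym = IsEquivalence.sym inOrbit-isEquivalence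

    inOrbit⇒sameVertex : ∀ {a b} → InOrbit a b → SameVertex u a b
    inOrbit⇒sameVertex     (inj₁ refl)        = EqClosure.reflexive _
    inOrbit⇒sameVertex {a} (inj₂ (inj₁ refl)) = sameVertex-σ a
    inOrbit⇒sameVertex {a} (inj₂ (inj₂ refl)) = EqClosure.transitive _ (sameVertex-σ a) (sameVertex-σ (σ a))

    sameVertex⇒inOrbit : ∀ {a b} → SameVertex u a b → InOrbit a b
    sameVertex⇒inOrbit = EqClosure.fold inOrbit-isEquivalence (inj₂ ∘ inj₁ ∘ step⇒σ)

    σ-Invariant : (Pos u → Set) → Set
    σ-Invariant P = ∀ k → P k → P (σ k)

    inOrbit-invariant : ∀ {P} → σ-Invariant P → ∀ {a b} → InOrbit a b → P b → P a
    inOrbit-invariant         P-σ     (inj₁ refl)        Pb = Pb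
    inOrbit-invariant {P = P} P-σ {a} (inj₂ (inj₁ refl)) Pb = subst P (σ³ a) (P-σ _ (P-σ _ Pb))
    inOrbit-invariant {P = P} P-σ {a} (inj₂ (inj₂ refl)) Pb = subst P (σ³ a) (P-σ _ Pb)

    IsPositive IsNegative : Pos u → Set
    IsPositive k = CyclicOrder k (σ k) (σ (σ k))
    IsNegative k = CyclicOrder k (σ (σ k)) (σ k)

    isPositive-σ : σ-Invariant IsPositive
    isPositive-σ k o = subst (CyclicOrder (σ k) (σ (σ k))) (sym (σ³ k)) (cyclicOrder-rotate o)

    isNegative-σ : σ-Invariant IsNegative
    isNegative-σ k o =
      subst (λ x → CyclicOrder (σ k) x (σ (σ k))) (sym (σ³ k)) (cyclicOrder-rotate (cyclicOrder-rotate o))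

    at-nxt-σσ : ∀ v → at u (nxt (σ (σ v))) ≡ inv (at u v)
    at-nxt-σσ v = subst (λ x → at u (nxt (σ (σ v))) ≡ inv (at u x)) (σ³ v) (at-nxt (σ (σ v)))

    positiveVertex⇒isPositive : ∀ {v} → PositiveVertex u v → IsPositive v
    positiveVertex⇒isPositive (i , j , k , o , vi , _ , _ , ij , jk , _)
      with refl ← σ-step⁻¹ ij | refl ← σ-step⁻¹ jk = inOrbit-invariant isPositive-σ (sameVertex⇒inOrbit vi) o

    isPositive⇒positiveVertex : ∀ {v} → IsPositive v → PositiveVertex u v
    isPositive⇒positiveVertex {v} o =
      v , σ v , σ (σ v) , o ,
      inOrbit⇒sameVertex (inj₁ refl) , inOrbit⇒sameVertex (inj₂ (inj₁ refl)) ,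
      inOrbit⇒sameVertex (inj₂ (inj₂ refl)) ,
      at-nxt v , at-nxt (σ v) , at-nxt-σσ v

    negativeVertex⇒isNegative : ∀ {v} → NegativeVertex u v → IsNegative v
    negativeVertex⇒isNegative (i , j , k , o , vi , _ , _ , ik , _ , kj)
      with refl ← σ-step⁻¹ ik | refl ← σ-step⁻¹ kj = inOrbit-invariant isNegative-σ (sameVertex⇒inOrbit vi) o

    isNegative⇒negativeVertex : ∀ {v} → IsNegative v → NegativeVertex u v
    isNegative⇒negativeVertex {v} o =
      v , σ (σ v) , σ v , o ,
      inOrbit⇒sameVertex (inj₁ refl) , inOrbit⇒sameVertex (inj₂ (inj₂ refl)) ,
      inOrbit⇒sameVertex (inj₂ (inj₁ refl)) ,
      at-nxt v , at-nxt-σσ v , at-nxt (σ v)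

    IsLeast : Pos u → Set
    IsLeast k = k < σ k × k < σ (σ k)

    isLeast? : ∀ k → Dec (IsLeast k)
    isLeast? k = (k <? σ k) ×-dec (k <? σ (σ k))

    least-unique : ∀ k →
      ⟦ does (isLeast? k) ⟧ + ⟦ does (isLeast? (σ k)) ⟧ + ⟦ does (isLeast? (σ (σ k))) ⟧ ≡ 1
    least-unique k with minimum-unique (σ≢ k ∘ sym) (σ≢ (σ k) ∘ sym) (σσ≢ k ∘ sym)
    ... | unique rewrite σ³ k = unique

    least-inOrbit-unique : ∀ {a b} → IsLeast a → IsLeast b → InOrbit a b → b ≡ a
    least-inOrbit-unique _ _ (inj₁ b≡a) = b≡a
    least-inOrbit-unique {a} (a<σa , _) (_ , b<σσb) (inj₂ (inj₁ refl)) =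
      ⊥-elim (Fin.<-asym a<σa (subst (σ a <_) (σ³ a) b<σσb))
    least-inOrbit-unique {a} (_ , a<σσa) (b<σb , _) (inj₂ (inj₂ refl)) =
      ⊥-elim (Fin.<-asym a<σσa (subst (σ (σ a) <_) (σ³ a) b<σb))

    least-inOrbit : ∀ k → ∃ λ m → InOrbit k m × IsLeast m
    least-inOrbit k with one-of-three (least-unique k)
    ... | inj₁ l              = k , inj₁ refl , does⇒ (isLeast? k) l
    ... | inj₂ (inj₁ l)       = σ k , inj₂ (inj₁ refl) , does⇒ (isLeast? (σ k)) l
    ... | inj₂ (inj₂ l)       = σ (σ k) , inj₂ (inj₂ refl) , does⇒ (isLeast? (σ (σ k))) l

    module Count {Q : Pos u → Set} (Q? : Decidable Q) (Q-σ : σ-Invariant Q) where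

      private
        rep? : ∀ k → Dec (Q k × IsLeast k)
        rep? k = Q? k ×-dec isLeast? k

      count : ℕ
      count = sum (λ k → ⟦ does (rep? k) ⟧)

      vertexCount : VertexCount u Q count
      vertexCount = reps , (proj₁ ∘ rep) , distinct , exhaustive
        where
        reps : Vec (Pos u) count
        reps = enumerate (does ∘ rep?)
        rep : ∀ i → Q (Vec.lookup reps i) × IsLeast (Vec.lookup reps i)
        rep i = does⇒ (rep? _) (enumerate-sound (does ∘ rep?) i)
        distinct : ∀ i j → SameVertex u (Vec.lookup reps i) (Vec.lookup reps j) → i ≡ j
        distinct i j same = enumerate-injective (does ∘ rep?)
          (sym (least-inOrbit-unique (proj₂ (rep i)) (proj₂ (rep j)) (sameVertex⇒inOrbit same)))
        exhaustive : ∀ k → Q k → ∃[ i ] SameVertex u k (Vec.lookup reps i)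
        exhaustive k Qk with m , k~m , least ← least-inOrbit k
                       with i , refl ← enumerate-complete (does ∘ rep?) m
                                         (dec-true (rep? m) (inOrbit-invariant Q-σ (inOrbit-sym k~m) Qk , least))
          = i , inOrbit⇒sameVertex k~m

      count-triple : count + count + count ≡ sum (λ k → ⟦ does (Q? k) ⟧)
      count-triple = begin
        count + count + count
          ≡⟨ sum-orbit₃ σ σ³ (λ k → ⟦ does (rep? k) ⟧) ⟨
        sum (λ k → ⟦ does (rep? k) ⟧ + ⟦ does (rep? (σ k)) ⟧ + ⟦ does (rep? (σ (σ k))) ⟧)
          ≡⟨ sum-cong-≗ one-rep-per-vertex ⟩
        sum (λ k → ⟦ does (Q? k) ⟧) ∎
        where
        open ≡-Reasoning
        does-Q-σ : ∀ k → does (Q? (σ k)) ≡ does (Q? k)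
        does-Q-σ k with Q? k
        ... | yes Qk = dec-true (Q? (σ k)) (Q-σ k Qk)
        ... | no ¬Qk = dec-false (Q? (σ k)) (¬Qk ∘ inOrbit-invariant Q-σ (inj₂ (inj₁ refl)))
        one-rep-per-vertex : ∀ k → ⟦ does (rep? k) ⟧ + ⟦ does (rep? (σ k)) ⟧ + ⟦ does (rep? (σ (σ k))) ⟧
                                   ≡ ⟦ does (Q? k) ⟧
        one-rep-per-vertex k rewrite does-Q-σ (σ k) | does-Q-σ k = ∧-one-of-three (does (Q? k)) (least-unique k)

    isPositive? : Decidable IsPositive
    isPositive? k = cyclicOrder? k (σ k) (σ (σ k))

    isNegative? : Decidable IsNegative
    isNegative? k = cyclicOrder? k (σ (σ k)) (σ k)

    module Positive = Count isPositive? isPositive-σ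
    module Negative = Count isNegative? isNegative-σ

    private
      distinct-corners : ∀ k → k ≢ σ k × σ k ≢ σ (σ k) × k ≢ σ (σ k)
      distinct-corners k = σ≢ k ∘ sym , σ≢ (σ k) ∘ sym , σσ≢ k ∘ sym

    sign-of-corner : ∀ k → ⟦ does (isPositive? k) ⟧ + ⟦ does (isNegative? k) ⟧ ≡ 1
    sign-of-corner k with k≢σk , σk≢σσk , k≢σσk ← distinct-corners k =
      orientation-unique k≢σk σk≢σσk k≢σσk

    descents-at-corner : ∀ k → ⟦ σ k <ᵇ k ⟧ + ⟦ σ (σ k) <ᵇ σ k ⟧ + ⟦ σ (σ (σ k)) <ᵇ σ (σ k) ⟧
      ≡ ⟦ does (isPositive? k) ⟧ + ⟦ does (isNegative? k) ⟧ + ⟦ does (isNegative? k) ⟧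
    descents-at-corner k with k≢σk , σk≢σσk , k≢σσk ← distinct-corners k
      rewrite σ³ k = descents-orientation k≢σk σk≢σσk k≢σσk

    sign-counts : Pos u → 6 * Positive.count + 6 ≡ length u × 6 * Negative.count ≡ length u + 6
    sign-counts p = sign-count-arithmetic {mp = Positive.count} {Negative.count}
      (sum-<ᵇ-involution τ τ-involutive τ≢) descents≡ signs three-descents
      Positive.count-triple Negative.count-triple
      where
      open ≡-Reasoning
      pos neg descent : Pos u → ℕ
      pos k     = ⟦ does (isPositive? k) ⟧
      neg k     = ⟦ does (isNegative? k) ⟧
      descent k = ⟦ σ k <ᵇ k ⟧

      descents≡ : sum descent ≡ 1 + sum (λ t → ⟦ τ t <ᵇ t ⟧)
      descents≡ = begin
        sum descent
          ≡⟨ sum-reindex descent prev nxt prev-nxt nxt-prev ⟨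
        sum (λ t → ⟦ τ (nxt (prev t)) <ᵇ prev t ⟧)
          ≡⟨ sum-cong-≗ (λ t → cong (λ x → ⟦ τ x <ᵇ prev t ⟧) (nxt-prev t)) ⟩
        sum (λ t → ⟦ τ t <ᵇ prev t ⟧)
          ≡⟨ sum-<ᵇ-prev p τ τ≢prev ⟩
        1 + sum (λ t → ⟦ τ t <ᵇ t ⟧) ∎

      signs : sum pos + sum neg ≡ length u
      signs = begin
        sum pos + sum neg              ≡⟨ ∑-distrib-+ pos neg ⟨
        sum (λ k → pos k + neg k)      ≡⟨ sum-cong-≗ sign-of-corner ⟩
        sum {length u} (λ _ → 1)       ≡⟨ sum-const-1 (length u) ⟩
        length u                       ∎

      three-descents : sum descent + sum descent + sum descent ≡ sum pos + sum neg + sum neg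
      three-descents = begin
        sum descent + sum descent + sum descent
          ≡⟨ sum-orbit₃ σ σ³ descent ⟨
        sum (λ k → descent k + descent (σ k) + descent (σ (σ k)))
          ≡⟨ sum-cong-≗ descents-at-corner ⟩
        sum (λ k → pos k + neg k + neg k)
          ≡⟨ ∑-distrib-+₃ pos neg neg ⟩
        sum pos + sum neg + sum neg ∎

    private
      count-determined : ∀ {P c} {R : ℕ → Set} → VertexCount u P c → R c → (∀ {m} → R m → m ≡ c) →
                         ∀ m → VertexCount u P m ⇔ R m
      count-determined {P} {R = R} count Rc R⇒≡c m = mk⇔
        (λ count′ → subst R (sym (VertexCount-unique {w = u} count′ count)) Rc)
        (λ Rm → subst (VertexCount u P) (sym (R⇒≡c Rm)) count)

    numPositive⇔ : Pos u → ∀ m → NumPositive u m ⇔ 6 * m + 6 ≡ length u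
    numPositive⇔ p = count-determined
      (VertexCount-resp {w = u} (λ _ → mk⇔ isPositive⇒positiveVertex positiveVertex⇒isPositive) Positive.vertexCount)
      (proj₁ (sign-counts p))
      (λ {m} eq → ℕ.*-cancelˡ-≡ m _ 6 (ℕ.+-cancelʳ-≡ 6 _ _ (trans eq (sym (proj₁ (sign-counts p))))))

    numNegative⇔ : Pos u → ∀ m → NumNegative u m ⇔ 6 * m ≡ length u + 6
    numNegative⇔ p = count-determined
      (VertexCount-resp {w = u} (λ _ → mk⇔ isNegative⇒negativeVertex negativeVertex⇒isNegative) Negative.vertexCount)
      (proj₂ (sign-counts p))
      (λ {m} eq → ℕ.*-cancelˡ-≡ m _ 6 (trans eq (sym (proj₂ (sign-counts p)))))

  -- Maximal forms are trivalent

  σ^ : Fin 3 → Pos u → Pos u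
  σ^ zero             a = a
  σ^ (suc zero)       a = σ a
  σ^ (suc (suc zero)) a = σ (σ a)

  sameVertex-σ^ : ∀ e a → SameVertex u a (σ^ e a)
  sameVertex-σ^ zero             a = EqClosure.reflexive _
  sameVertex-σ^ (suc zero)       a = sameVertex-σ a
  sameVertex-σ^ (suc (suc zero)) a = EqClosure.transitive _ (sameVertex-σ a) (sameVertex-σ (σ a))

  module _ (c3 : Cond3 u) where

    σσ≢-cond3 : ∀ k → σ (σ k) ≢ k
    σσ≢-cond3 k eq = c3 k (σ k) (σ-step k , subst (λ x → at u (nxt (σ k)) ≡ inv (at u x)) eq (at-nxt (σ k)))

    σ^-injective : ∀ {a} e e′ → σ^ e a ≡ σ^ e′ a → e ≡ e′
    σ^-injective zero             zero             _  = refl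
    σ^-injective zero             (suc zero)       eq = ⊥-elim (σ≢ _ (sym eq))
    σ^-injective zero             (suc (suc zero)) eq = ⊥-elim (σσ≢-cond3 _ (sym eq))
    σ^-injective (suc zero)       zero             eq = ⊥-elim (σ≢ _ eq)
    σ^-injective (suc zero)       (suc zero)       _  = refl
    σ^-injective (suc zero)       (suc (suc zero)) eq = ⊥-elim (σ≢ _ (sym (σ-injective eq)))
    σ^-injective (suc (suc zero)) zero             eq = ⊥-elim (σσ≢-cond3 _ eq)
    σ^-injective (suc (suc zero)) (suc zero)       eq = ⊥-elim (σ≢ _ (σ-injective eq))
    σ^-injective (suc (suc zero)) (suc (suc zero)) _  = refl

    σ^≡σ³⇒σ³≡id : ∀ {a} e → σ^ e a ≡ σ (σ (σ a)) → σ (σ (σ a)) ≡ a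
    σ^≡σ³⇒σ³≡id zero             eq = sym eq
    σ^≡σ³⇒σ³≡id (suc zero)       eq = ⊥-elim (σσ≢-cond3 _ (sym (σ-injective eq)))
    σ^≡σ³⇒σ³≡id (suc (suc zero)) eq = ⊥-elim (σ≢ _ (sym (σ-injective (σ-injective eq))))

    -- σ has no orbits of length 1 or 2, so V vertices have at least 3V corners,
    -- with equality only if every orbit has length 3.
    trivalent : ∀ {V} → VertexCount u (λ _ → ⊤) V → V * 3 ≡ length u → Trivalent
    trivalent {V} (v , _ , distinct , _) 3V≡n = σ³
      where
      same-vertex : ∀ {i i′ k} → SameVertex u (Vec.lookup v i) k → SameVertex u (Vec.lookup v i′) k → i ≡ i′
      same-vertex ik i′k = distinct _ _ (EqClosure.transitive _ ik (EqClosure.symmetric _ i′k))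

      corner : Fin V × Fin 3 → Pos u
      corner (i , e) = σ^ e (Vec.lookup v i)

      corner-injective : ∀ {x y} → corner x ≡ corner y → x ≡ y
      corner-injective {i , e} {i′ , e′} eq
        with refl ← same-vertex (sameVertex-σ^ e _) (subst (SameVertex u _) (sym eq) (sameVertex-σ^ e′ _))
        = cong (i ,_) (σ^-injective e e′ eq)

      corner∘remQuot-injective : ∀ {t t′} → corner (remQuot {V} 3 t) ≡ corner (remQuot 3 t′) → t ≡ t′
      corner∘remQuot-injective {t} {t′} eq = begin
        t                                  ≡⟨ combine-remQuot {V} 3 t ⟨
        uncurry combine (remQuot {V} 3 t)  ≡⟨ cong (uncurry combine) (corner-injective eq) ⟩
        uncurry combine (remQuot {V} 3 t′) ≡⟨ combine-remQuot {V} 3 t′ ⟩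
        t′                                 ∎
        where open ≡-Reasoning

      surjective : ∀ k → ∃ λ x → corner x ≡ k
      surjective k with t , eq ← injective⇒surjective (corner ∘ remQuot {V} 3) corner∘remQuot-injective 3V≡n k
        = remQuot {V} 3 t , eq

      σ³-rep : ∀ i → σ (σ (σ (Vec.lookup v i))) ≡ Vec.lookup v i
      σ³-rep i with (_ , e) , eq ← surjective (σ (σ (σ (Vec.lookup v i))))
               with refl ← same-vertex (subst (SameVertex u _) eq (sameVertex-σ^ e _))
                                       (EqClosure.transitive _ (sameVertex-σ^ (suc (suc zero)) _) (sameVertex-σ _))
        = σ^≡σ³⇒σ³≡id e eq

      σ³-corner : ∀ x → σ (σ (σ (corner x))) ≡ corner x
      σ³-corner (i , zero)           = σ³-rep i
      σ³-corner (i , suc zero)       = cong σ (σ³-rep i)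
      σ³-corner (i , suc (suc zero)) = cong (σ ∘ σ) (σ³-rep i)

      σ³ : Trivalent
      σ³ k with x , refl ← surjective k = σ³-corner x

  maximal⇒trivalent : Cond3 u → Maximal u → Pos u → Trivalent
  maximal⇒trivalent c3 (g , (V , _ , count , n≡2E , euler) , n≡) p =
    trivalent c3 count (maximal-arithmetic {g = g} {V} (ℕ.≤-<-trans ℕ.z≤n (Fin.toℕ<n p)) n≡2E euler n≡)

module _ {A : Set} where

  data Segment (f : A → A) : A → List A → A → Set where
    stop : ∀ {a} → Segment f a [] a
    step : ∀ {a xs z} → Segment f (f a) xs z → Segment f a (a ∷ xs) z

  Cycle : (A → A) → List A → Set
  Cycle f xs = ∃ λ a → Segment f a xs a

  module _ {f : A → A} where

    segment-++ : ∀ {a m z xs ys} → Segment f a xs m → Segment f m ys z → Segment f a (xs ++ ys) z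
    segment-++ stop       s = s
    segment-++ (step s′) s = step (segment-++ s′ s)

    segment-split : ∀ {a z} xs {ys} → Segment f a (xs ++ ys) z → ∃ λ m → Segment f a xs m × Segment f m ys z
    segment-split []       s        = _ , stop , s
    segment-split (x ∷ xs) (step s) with m , s₁ , s₂ ← segment-split xs s = m , step s₁ , s₂

    cycle-rotate : ∀ {xs} k → Cycle f xs → Cycle f (drop k xs ++ take k xs)
    cycle-rotate {xs} k (a , s)
      with m , s₁ , s₂ ← segment-split (take k xs)
                            (subst (λ ys → Segment f a ys a) (sym (List.take++drop≡id k xs)) s)
      = m , segment-++ s₂ s₁

    f∘iterate : ∀ a k → f (iterate f a k) ≡ iterate f a (suc k)
    f∘iterate a ℕ.zero    = refl
    f∘iterate a (suc k) = f∘iterate (f a) k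

    segment-lookup : ∀ {a xs z} → Segment f a xs z → ∀ j → lookup xs j ≡ iterate f a (toℕ j)
    segment-lookup (step s) zero    = refl
    segment-lookup (step s) (suc j) = segment-lookup s j

    segment-end : ∀ {a xs z} → Segment f a xs z → z ≡ iterate f a (length xs)
    segment-end stop     = refl
    segment-end (step s) = segment-end s

    cycle-lookup : ∀ {xs} → Cycle f xs → ∀ j → lookup xs (nxt j) ≡ f (lookup xs j)
    cycle-lookup {x ∷ xs} (a , s) j = begin
      lookup (x ∷ xs) (nxt j)          ≡⟨ segment-lookup s (nxt j) ⟩
      iterate f a (toℕ (nxt j))        ≡⟨ iterate-nxt ⟩
      iterate f a (suc (toℕ j))        ≡⟨ f∘iterate a (toℕ j) ⟨
      f (iterate f a (toℕ j))          ≡⟨ cong f (segment-lookup s j) ⟨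
      f (lookup (x ∷ xs) j)            ∎
      where
      open ≡-Reasoning
      iterate-nxt : iterate f a (toℕ (nxt j)) ≡ iterate f a (suc (toℕ j))
      iterate-nxt with ℕ.m<1+n⇒m<n∨m≡n (toℕ<n j)
      ... | inj₁ j<n = cong (iterate f a) (trans (toℕ-nxt j) (m<n⇒m%n≡m (ℕ.s≤s j<n)))
      ... | inj₂ j≡n = begin
        iterate f a (toℕ (nxt j))             ≡⟨ cong (iterate f a) (trans (toℕ-nxt j)
                                                   (trans (cong (λ i → suc i % suc (length xs)) j≡n)
                                                          (n%n≡0 (suc (length xs))))) ⟩
        a                                     ≡⟨ segment-end s ⟩
        iterate f a (length (x ∷ xs))         ≡⟨ cong (iterate f a ∘ suc) j≡n ⟨
        iterate f a (suc (toℕ j))             ∎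

segment-tabulate : ∀ {m n} (h : Fin (suc m) → Fin n) → (∀ j → h (suc j) ≡ nxt (h (inject₁ j))) →
                   Segment nxt (h zero) (tabulate h) (nxt (h (fromℕ m)))
segment-tabulate {ℕ.zero} h h-nxt = step stop
segment-tabulate {suc m}  h h-nxt =
  step (subst (λ i → Segment nxt i (tabulate (h ∘ suc)) (nxt (h (fromℕ (suc m))))) (h-nxt zero)
              (segment-tabulate (h ∘ suc) (h-nxt ∘ suc)))

allFin-cycle : ∀ {n} → Fin n → Cycle nxt (allFin n)
allFin-cycle {suc m} _ = zero , subst (Segment nxt zero (allFin (suc m))) nxt-last
  (segment-tabulate (λ i → i) (λ j → toℕ-injective (sym (nxt-inject₁ j))))
  where
  nxt-inject₁ : ∀ j → toℕ (nxt (inject₁ j)) ≡ suc (toℕ j)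
  nxt-inject₁ j = trans (toℕ-nxt (inject₁ j)) (trans (cong (λ i → suc i % suc m) (toℕ-inject₁ j))
    (m<n⇒m%n≡m (ℕ.s≤s (toℕ<n j))))
  nxt-last : nxt (fromℕ m) ≡ zero
  nxt-last = toℕ-injective (trans (toℕ-nxt (fromℕ m))
    (trans (cong (λ i → suc i % suc m) (toℕ-fromℕ m)) (n%n≡0 (suc m))))

segment-concatMap : ∀ {A B : Set} {f : A → A} {g : B → B} (E : A → B) (blocks : A → List B) →
                    (∀ i → Segment g (E i) (blocks i) (E (f i))) →
                    ∀ {i is j} → Segment f i is j → Segment g (E i) (concatMap blocks is) (E j)
segment-concatMap E blocks block-segment stop     = stop
segment-concatMap E blocks block-segment (step s) =
  segment-++ (block-segment _) (segment-concatMap E blocks block-segment s)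

cycle-concatMap : ∀ {A B : Set} {f : A → A} {g : B → B} (E : A → B) (blocks : A → List B) →
                  (∀ i → Segment g (E i) (blocks i) (E (f i))) →
                  ∀ {is} → Cycle f is → Cycle g (concatMap blocks is)
cycle-concatMap E blocks block-segment (i , s) = E i , segment-concatMap E blocks block-segment s

length-concatMap-allFin : ∀ {A : Set} {n} (f : Fin n → List A) →
                          length (concatMap f (allFin n)) ≡ sum (length ∘ f)
length-concatMap-allFin {n = ℕ.zero} f = refl
length-concatMap-allFin {n = suc n}  f = begin
  length (f zero ++ concatMap f (tabulate suc))          ≡⟨ List.length-++ (f zero) ⟩
  length (f zero) + length (concatMap f (tabulate suc))  ≡⟨ cong (λ xs → length (f zero) + length (concatMap f xs))
                                                                 (List.map-tabulate (λ i → i) suc) ⟨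
  length (f zero) + length (concatMap f (map suc (allFin n))) ≡⟨ cong (λ xs → length (f zero) + length xs)
                                                                     (List.concatMap-map f suc (allFin n)) ⟩
  length (f zero) + length (concatMap (f ∘ suc) (allFin n)) ≡⟨ cong (length (f zero) +_) (length-concatMap-allFin (f ∘ suc)) ⟩
  length (f zero) + sum (length ∘ f ∘ suc)               ∎
  where open ≡-Reasoning

lookup-map : ∀ {A B : Set} (f : A → B) (xs : List A) i →
             lookup (map f xs) i ≡ f (lookup xs (cast (List.length-map f xs) i))
lookup-map f (x ∷ xs) zero    = refl
lookup-map f (x ∷ xs) (suc i) = lookup-map f xs i

lookup-injective : ∀ {A : Set} {xs : List A} → Unique xs → ∀ {i j} → lookup xs i ≡ lookup xs j → i ≡ j
lookup-injective (_  ∷ _) {zero}  {zero}  _  = refl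
lookup-injective (x∉ ∷ _) {zero}  {suc j} eq = ⊥-elim (All.lookup x∉ (∈-lookup j) eq)
lookup-injective (x∉ ∷ _) {suc i} {zero}  eq = ⊥-elim (All.lookup x∉ (∈-lookup i) (sym eq))
lookup-injective (_  ∷ u) {suc i} {suc j} eq = cong suc (lookup-injective u eq)

cast-nxt : ∀ {m n} (eq : m ≡ n) (t : Fin m) → cast eq (nxt t) ≡ nxt (cast eq t)
cast-nxt refl t = trans (cast-is-id refl (nxt t)) (cong nxt (sym (cast-is-id refl t)))

record TrivalentWicks (u : List Letter) : Set where
  field
    cond1     : Cond1 u
    cond2     : Cond2 u
    trivalent : Corners.Trivalent u cond1 cond2

module TokenWord {T : Set} (lab : T → Letter) (lab-injective : ∀ {x y} → lab x ≡ lab y → x ≡ y)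
                 (ι : T → T) (ι-lab : ∀ x → lab (ι x) ≡ inv (lab x)) (succ : T → T)
                 {L : List T} (unique : Unique L) (cycle : Cycle succ L) (ι-∈ : ∀ {x} → x ∈ L → ι x ∈ L)
                 where

  u : List Letter
  u = map lab L

  tok : Pos u → T
  tok t = lookup L (cast (List.length-map lab L) t)

  tok-at : ∀ t → at u t ≡ lab (tok t)
  tok-at = lookup-map lab L

  tok-nxt : ∀ t → tok (nxt t) ≡ succ (tok t)
  tok-nxt t = trans (cong (lookup L) (cast-nxt (List.length-map lab L) t)) (cycle-lookup cycle _)

  tok-∈ : ∀ t → tok t ∈ L
  tok-∈ t = ∈-lookup _

  tok-injective : ∀ {t t′} → tok t ≡ tok t′ → t ≡ t′
  tok-injective {t} {t′} eq = toℕ-injective (begin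
    toℕ t                                    ≡⟨ toℕ-cast _ t ⟨
    toℕ (cast (List.length-map lab L) t)     ≡⟨ cong toℕ (lookup-injective unique eq) ⟩
    toℕ (cast (List.length-map lab L) t′)    ≡⟨ toℕ-cast _ t′ ⟩
    toℕ t′                                   ∎)
    where open ≡-Reasoning

  tok-surjective : ∀ {x} → x ∈ L → ∃ λ t → tok t ≡ x
  tok-surjective {x} x∈L = cast (sym (List.length-map lab L)) (Any.index x∈L) , (begin
    tok (cast (sym (List.length-map lab L)) (Any.index x∈L))
      ≡⟨ cong (lookup L) (toℕ-injective (trans (toℕ-cast (List.length-map lab L) _)
                                               (toℕ-cast (sym (List.length-map lab L)) (Any.index x∈L)))) ⟩
    lookup L (Any.index x∈L)                    ≡⟨ Any.lookup-index x∈L ⟨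
    x                                           ∎)
    where open ≡-Reasoning

  lab-tok-injective : ∀ {t t′} → at u t ≡ at u t′ → t ≡ t′
  lab-tok-injective {t} {t′} eq = tok-injective (lab-injective (trans (sym (tok-at t)) (trans eq (tok-at t′))))

  cond1 : Cond1 u
  cond1 i = j , at-j , λ k at-k → lab-tok-injective (trans at-k (sym at-j))
    where
    j : Pos u
    j = proj₁ (tok-surjective (ι-∈ (tok-∈ i)))
    at-j : at u j ≡ inv (at u i)
    at-j = begin
      at u j              ≡⟨ tok-at j ⟩
      lab (tok j)         ≡⟨ cong lab (proj₂ (tok-surjective (ι-∈ (tok-∈ i)))) ⟩
      lab (ι (tok i))     ≡⟨ ι-lab (tok i) ⟩
      inv (lab (tok i))   ≡⟨ cong inv (tok-at i) ⟨
      inv (at u i)        ∎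
      where open ≡-Reasoning

  cond2 : (∀ {x} → x ∈ L → succ x ≢ ι x) → Cond2 u
  cond2 succ≢ι i eq = succ≢ι (tok-∈ i) (lab-injective (begin
    lab (succ (tok i))   ≡⟨ cong lab (tok-nxt i) ⟨
    lab (tok (nxt i))    ≡⟨ tok-at (nxt i) ⟨
    at u (nxt i)         ≡⟨ eq ⟩
    inv (at u i)         ≡⟨ cong inv (tok-at i) ⟩
    inv (lab (tok i))    ≡⟨ ι-lab (tok i) ⟨
    lab (ι (tok i))      ∎))
    where open ≡-Reasoning

  trivalentWicks : (succ≢ι : ∀ {x} → x ∈ L → succ x ≢ ι x) →
                   (∀ {x} → x ∈ L → ι (succ (ι (succ (ι (succ x))))) ≡ x) → TrivalentWicks u
  trivalentWicks succ≢ι σ′³ = record { cond1 = cond1 ; cond2 = cond2 succ≢ι ; trivalent = σ³ }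
    where
    open Corners u cond1 (cond2 succ≢ι) using (σ; Trivalent)
    tok-σ : ∀ k → tok (σ k) ≡ ι (succ (tok k))
    tok-σ k = trans (proj₂ (tok-surjective (ι-∈ (tok-∈ (nxt k))))) (cong ι (tok-nxt k))
    σ³ : Trivalent
    σ³ k = tok-injective (begin
      tok (σ (σ (σ k)))                          ≡⟨ tok-σ (σ (σ k)) ⟩
      ι (succ (tok (σ (σ k))))                   ≡⟨ cong (ι ∘ succ) (tok-σ (σ k)) ⟩
      ι (succ (ι (succ (tok (σ k)))))            ≡⟨ cong (ι ∘ succ ∘ ι ∘ succ) (tok-σ k) ⟩
      ι (succ (ι (succ (ι (succ (tok k))))))     ≡⟨ σ′³ (tok-∈ k) ⟩
      tok k                                      ∎)
      where open ≡-Reasoning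

-- The IH-transformation

-- In the notation of the paper x is the letter at p, the factors a x b and
-- c x⁻¹ d sit at the positions a p b and c q d, and y, y⁻¹ are inserted
-- before the positions r, s of a⁻¹, c⁻¹.
module IHTransformation {w : List Letter} (c1 : Cond1 w) (c2 : Cond2 w) (σ³ : Corners.Trivalent w c1 c2) (p : Pos w) where

  open Corners w c1 c2
  open OfTrivalent σ³

  q a b c d r s : Pos w
  q = τ p
  a = prev p
  b = nxt p
  c = prev q
  d = nxt q
  r = τ a
  s = τ c

  σ-a : σ a ≡ q
  σ-a = cong τ (nxt-prev p)

  σ-c : σ c ≡ p
  σ-c = trans (cong τ (nxt-prev q)) (τ-involutive p)

  σ-τd : σ (τ d) ≡ a
  σ-τd = trans (cong (σ ∘ σ) (sym σ-a)) (σ³ a)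

  σ-τb : σ (τ b) ≡ c
  σ-τb = trans (cong (σ ∘ σ) (sym σ-c)) (σ³ c)

  nxt-τd : nxt (τ d) ≡ r
  nxt-τd = trans (nxt≡τσ (τ d)) (cong τ σ-τd)

  nxt-τb : nxt (τ b) ≡ s
  nxt-τb = trans (nxt≡τσ (τ b)) (cong τ σ-τb)

  private
    prev≢ : ∀ {i j : Pos w} → nxt j ≢ i → prev i ≢ j
    prev≢ {i} nxt-j≢i eq = nxt-j≢i (trans (cong nxt (sym eq)) (nxt-prev i))

    τ≢′ : ∀ {i j : Pos w} → i ≢ τ j → τ i ≢ j
    τ≢′ {i} i≢τj eq = i≢τj (trans (sym (τ-involutive i)) (cong τ eq))

  p≢q : p ≢ q
  p≢q = τ≢ p ∘ sym

  b≢p : b ≢ p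
  b≢p = nxt≢ p≢q

  d≢q : d ≢ q
  d≢q = nxt≢ (p≢q ∘ sym)

  b≢q : b ≢ q
  b≢q = nxt≢τ p

  d≢p : d ≢ p
  d≢p eq = nxt≢τ q (trans eq (sym (τ-involutive p)))

  r≢p : r ≢ p
  r≢p = τ≢′ (prev≢ d≢p)

  r≢q : r ≢ q
  r≢q = prev≢ b≢p ∘ τ-injective

  s≢p : s ≢ p
  s≢p = τ≢′ (prev≢ d≢q)

  s≢q : s ≢ q
  s≢q = prev≢ b≢q ∘ τ-injective

  r≢s : r ≢ s
  r≢s = p≢q ∘ prev-injective ∘ τ-injective

  b≢r : b ≢ r
  b≢r eq = prev≢ d≢q (trans (sym σ-τb) (trans (cong σ (trans (cong τ eq) (τ-involutive a))) σ-a))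

  b≢s : b ≢ s
  b≢s eq = σσ≢ p (trans (cong σ (trans (cong τ eq) (τ-involutive c))) σ-c)

  d≢r : d ≢ r
  d≢r eq = σσ≢ a (trans (cong σ σ-a) (trans (cong τ eq) (τ-involutive a)))

  d≢s : d ≢ s
  d≢s eq = prev≢ b≢p (trans (sym σ-τd) (trans (cong σ (trans (cong τ eq) (τ-involutive c))) σ-c))

  Kept : Pos w → Set
  Kept i = i ≢ p × i ≢ q

  data Token : Set where
    old   : Pos w → Token
    y⁺ y⁻ : Token

  Valid : Token → Set
  Valid (old i) = Kept i
  Valid y⁺      = ⊤
  Valid y⁻      = ⊤

  block : Pos w → List Token
  block i = if does (i ≟ p) then []
            else if does (i ≟ q) then []
            else if does (i ≟ r) then y⁺ ∷ old i ∷ []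
            else if does (i ≟ s) then y⁻ ∷ old i ∷ []
            else old i ∷ []

  tokens : List Token
  tokens = concatMap block (allFin (length w))

  skip : Pos w → Pos w
  skip i = if does (i ≟ p) then nxt i else if does (i ≟ q) then nxt i else i

  entry : Pos w → Token
  entry i = if does (i ≟ r) then y⁺ else if does (i ≟ s) then y⁻ else old i

  succ : Token → Token
  succ (old i) = entry (skip (nxt i))
  succ y⁺      = old r
  succ y⁻      = old s

  ι : Token → Token
  ι (old i) = old (τ i)
  ι y⁺      = y⁻
  ι y⁻      = y⁺

  data Class : Pos w → Set where
    is-p  : Class p
    is-q  : Class q
    is-r  : Class r
    is-s  : Class s
    plain : ∀ {i} → Kept i → i ≢ r → i ≢ s → Class i

  classify : ∀ i → Class i
  classify i with i ≟ p | i ≟ q | i ≟ r | i ≟ s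
  ... | yes refl | _        | _        | _        = is-p
  ... | no _     | yes refl | _        | _        = is-q
  ... | no _     | no _     | yes refl | _        = is-r
  ... | no _     | no _     | no _     | yes refl = is-s
  ... | no i≢p   | no i≢q   | no i≢r   | no i≢s   = plain (i≢p , i≢q) i≢r i≢s

  block-p : block p ≡ []
  block-p rewrite dec-true (p ≟ p) refl = refl

  block-q : block q ≡ []
  block-q rewrite dec-false (q ≟ p) (p≢q ∘ sym) | dec-true (q ≟ q) refl = refl

  block-r : block r ≡ y⁺ ∷ old r ∷ []
  block-r rewrite dec-false (r ≟ p) r≢p | dec-false (r ≟ q) r≢q | dec-true (r ≟ r) refl = refl

  block-s : block s ≡ y⁻ ∷ old s ∷ []
  block-s rewrite dec-false (s ≟ p) s≢p | dec-false (s ≟ q) s≢q | dec-false (s ≟ r) (r≢s ∘ sym)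
                | dec-true (s ≟ s) refl = refl

  block-plain : ∀ {i} → Kept i → i ≢ r → i ≢ s → block i ≡ old i ∷ []
  block-plain {i} (i≢p , i≢q) i≢r i≢s
    rewrite dec-false (i ≟ p) i≢p | dec-false (i ≟ q) i≢q
          | dec-false (i ≟ r) i≢r | dec-false (i ≟ s) i≢s = refl

  skip-p : skip p ≡ b
  skip-p rewrite dec-true (p ≟ p) refl = refl

  skip-q : skip q ≡ d
  skip-q rewrite dec-false (q ≟ p) (p≢q ∘ sym) | dec-true (q ≟ q) refl = refl

  skip-kept : ∀ {i} → Kept i → skip i ≡ i
  skip-kept {i} (i≢p , i≢q) rewrite dec-false (i ≟ p) i≢p | dec-false (i ≟ q) i≢q = refl

  entry-r : entry r ≡ y⁺
  entry-r rewrite dec-true (r ≟ r) refl = refl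

  entry-s : entry s ≡ y⁻
  entry-s rewrite dec-false (s ≟ r) (r≢s ∘ sym) | dec-true (s ≟ s) refl = refl

  entry-plain : ∀ {i} → i ≢ r → i ≢ s → entry i ≡ old i
  entry-plain {i} i≢r i≢s rewrite dec-false (i ≟ r) i≢r | dec-false (i ≟ s) i≢s = refl

  block-segment : ∀ i → Segment succ (entry (skip i)) (block i) (entry (skip (nxt i)))
  block-segment i with classify i
  ... | is-p rewrite block-p | skip-p | skip-kept (b≢p , b≢q) = stop
  ... | is-q rewrite block-q | skip-q | skip-kept (d≢p , d≢q) = stop
  ... | is-r rewrite block-r | skip-kept (r≢p , r≢q) | entry-r = step (step stop)
  ... | is-s rewrite block-s | skip-kept (s≢p , s≢q) | entry-s = step (step stop)
  ... | plain kept i≢r i≢s rewrite block-plain kept i≢r i≢s | skip-kept kept | entry-plain i≢r i≢s = step stop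

  tokens-cycle : Cycle succ tokens
  tokens-cycle = cycle-concatMap (entry ∘ skip) block block-segment (allFin-cycle p)

  owner : Token → Pos w
  owner (old i) = i
  owner y⁺      = r
  owner y⁻      = s

  ∈-block : ∀ {x} i → x ∈ block i → Valid x × owner x ≡ i
  ∈-block i x∈ with classify i
  ... | is-p with () ← subst (_ ∈_) block-p x∈
  ... | is-q with () ← subst (_ ∈_) block-q x∈
  ... | is-r with subst (_ ∈_) block-r x∈
  ...   | here refl         = tt , refl
  ...   | there (here refl) = (r≢p , r≢q) , refl
  ∈-block i x∈ | is-s with subst (_ ∈_) block-s x∈
  ...   | here refl         = tt , refl
  ...   | there (here refl) = (s≢p , s≢q) , refl
  ∈-block i x∈ | plain kept i≢r i≢s with subst (_ ∈_) (block-plain kept i≢r i≢s) x∈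
  ...   | here refl         = kept , refl

  ∈-block-owner : ∀ {x} → Valid x → x ∈ block (owner x)
  ∈-block-owner {y⁺} _ = subst (y⁺ ∈_) (sym block-r) (here refl)
  ∈-block-owner {y⁻} _ = subst (y⁻ ∈_) (sym block-s) (here refl)
  ∈-block-owner {old i} (i≢p , i≢q) with classify i
  ... | is-p                = ⊥-elim (i≢p refl)
  ... | is-q                = ⊥-elim (i≢q refl)
  ... | is-r                = subst (old r ∈_) (sym block-r) (there (here refl))
  ... | is-s                = subst (old s ∈_) (sym block-s) (there (here refl))
  ... | plain kept i≢r i≢s  = subst (old i ∈_) (sym (block-plain kept i≢r i≢s)) (here refl)

  ∈-tokens⇔ : ∀ x → x ∈ tokens ⇔ Valid x
  ∈-tokens⇔ x = mk⇔
    (λ x∈ → let i , x∈i = Any.satisfied (∈-concatMap⁻ block {allFin (length w)} x∈) in proj₁ (∈-block i x∈i))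
    (λ valid → ∈-concatMap⁺ block (Any.map (λ { refl → ∈-block-owner valid }) (∈-allFin (owner x))))

  tokens-unique : Unique tokens
  tokens-unique = Unique.concat⁺ (All.map⁺ (All.universal block-unique _))
                    (AllPairs.map⁺ (AllPairs.map block-disjoint (Unique.allFin⁺ _)))
    where
    block-unique : ∀ i → Unique (block i)
    block-unique i with classify i
    ... | is-p rewrite block-p = []
    ... | is-q rewrite block-q = []
    ... | is-r rewrite block-r = ((λ ()) ∷ []) ∷ [] ∷ []
    ... | is-s rewrite block-s = ((λ ()) ∷ []) ∷ [] ∷ []
    ... | plain kept i≢r i≢s rewrite block-plain kept i≢r i≢s = [] ∷ []
    block-disjoint : ∀ {i j} → i ≢ j → Disjoint (block i) (block j)
    block-disjoint i≢j (x∈i , x∈j) = i≢j (trans (sym (proj₂ (∈-block _ x∈i))) (proj₂ (∈-block _ x∈j)))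

  length-block : ∀ i → length (block i) + ⟦ does (i ≟ p) ⟧ + ⟦ does (i ≟ q) ⟧
                     ≡ 1 + ⟦ does (i ≟ r) ⟧ + ⟦ does (i ≟ s) ⟧
  length-block i with classify i
  ... | is-p rewrite block-p | dec-true (p ≟ p) refl | dec-false (p ≟ q) p≢q
                   | dec-false (p ≟ r) (r≢p ∘ sym) | dec-false (p ≟ s) (s≢p ∘ sym) = refl
  ... | is-q rewrite block-q | dec-false (q ≟ p) (p≢q ∘ sym) | dec-true (q ≟ q) refl
                   | dec-false (q ≟ r) (r≢q ∘ sym) | dec-false (q ≟ s) (s≢q ∘ sym) = refl
  ... | is-r rewrite block-r | dec-false (r ≟ p) r≢p | dec-false (r ≟ q) r≢q
                   | dec-true (r ≟ r) refl | dec-false (r ≟ s) r≢s = refl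
  ... | is-s rewrite block-s | dec-false (s ≟ p) s≢p | dec-false (s ≟ q) s≢q
                   | dec-false (s ≟ r) (r≢s ∘ sym) | dec-true (s ≟ s) refl = refl
  ... | plain kept@(i≢p , i≢q) i≢r i≢s rewrite block-plain kept i≢r i≢s | dec-false (i ≟ p) i≢p
                   | dec-false (i ≟ q) i≢q | dec-false (i ≟ r) i≢r | dec-false (i ≟ s) i≢s = refl

  length-tokens : length tokens ≡ length w
  length-tokens = ℕ.+-cancelʳ-≡ 1 _ _ (ℕ.+-cancelʳ-≡ 1 _ _ (begin
    length tokens + 1 + 1
      ≡⟨ cong₂ (λ x y → x + y + 1) (length-concatMap-allFin block) (sym (sum-≟ p)) ⟩
    sum (length ∘ block) + ⟦ p ⟧≟ + 1
      ≡⟨ cong (sum (length ∘ block) + ⟦ p ⟧≟ +_) (sum-≟ q) ⟨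
    sum (length ∘ block) + ⟦ p ⟧≟ + ⟦ q ⟧≟
      ≡⟨ ∑-distrib-+₃ (length ∘ block) (λ i → ⟦ does (i ≟ p) ⟧) (λ i → ⟦ does (i ≟ q) ⟧) ⟨
    sum (λ i → length (block i) + ⟦ does (i ≟ p) ⟧ + ⟦ does (i ≟ q) ⟧)
      ≡⟨ sum-cong-≗ length-block ⟩
    sum (λ i → 1 + ⟦ does (i ≟ r) ⟧ + ⟦ does (i ≟ s) ⟧)
      ≡⟨ ∑-distrib-+₃ (λ _ → 1) (λ i → ⟦ does (i ≟ r) ⟧) (λ i → ⟦ does (i ≟ s) ⟧) ⟩
    sum {length w} (λ _ → 1) + ⟦ r ⟧≟ + ⟦ s ⟧≟
      ≡⟨ cong₂ (λ x y → x + y + ⟦ s ⟧≟) (sum-const-1 (length w)) (sum-≟ r) ⟩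
    length w + 1 + ⟦ s ⟧≟
      ≡⟨ cong (length w + 1 +_) (sum-≟ s) ⟩
    length w + 1 + 1 ∎))
    where
    open ≡-Reasoning
    ⟦_⟧≟ : Pos w → ℕ
    ⟦ x ⟧≟ = sum (λ i → ⟦ does (i ≟ x) ⟧)

  ι-valid : ∀ {x} → Valid x → Valid (ι x)
  ι-valid {old i} (i≢p , i≢q) = (λ τi≡p → i≢q (trans (sym (τ-involutive i)) (cong τ τi≡p))) ,
                                (λ τi≡q → i≢p (τ-injective τi≡q))
  ι-valid {y⁺} _ = tt
  ι-valid {y⁻} _ = tt

  σ′ : Token → Token
  σ′ = ι ∘ succ

  old-injective : ∀ {i j} → old i ≡ old j → i ≡ j
  old-injective refl = refl

  three-cycle : ∀ {x x₁ x₂} → σ′ x ≡ x₁ → σ′ x₁ ≡ x₂ → σ′ x₂ ≡ x → σ′ (σ′ (σ′ x)) ≡ x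
  three-cycle e₀ e₁ e₂ = trans (cong (σ′ ∘ σ′) e₀) (trans (cong σ′ e₁) e₂)

  succ-old : ∀ {k} → Kept (nxt k) → succ (old k) ≡ entry (nxt k)
  succ-old kept = cong entry (skip-kept kept)

  succ-a : succ (old a) ≡ old b
  succ-a = trans (cong (entry ∘ skip) (nxt-prev p)) (trans (cong entry skip-p) (entry-plain b≢r b≢s))

  succ-c : succ (old c) ≡ old d
  succ-c = trans (cong (entry ∘ skip) (nxt-prev q)) (trans (cong entry skip-q) (entry-plain d≢r d≢s))

  succ-τd : succ (old (τ d)) ≡ y⁺
  succ-τd = trans (cong (entry ∘ skip) nxt-τd) (trans (cong entry (skip-kept (r≢p , r≢q))) entry-r)

  succ-τb : succ (old (τ b)) ≡ y⁻
  succ-τb = trans (cong (entry ∘ skip) nxt-τb) (trans (cong entry (skip-kept (s≢p , s≢q))) entry-s)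

  σ′-y⁺ : σ′ y⁺ ≡ old a
  σ′-y⁺ = cong old (τ-involutive a)

  σ′-y⁻ : σ′ y⁻ ≡ old c
  σ′-y⁻ = cong old (τ-involutive c)

  σ′-a : σ′ (old a) ≡ old (τ b)
  σ′-a = cong ι succ-a

  σ′-c : σ′ (old c) ≡ old (τ d)
  σ′-c = cong ι succ-c

  σ′-τb : σ′ (old (τ b)) ≡ y⁺
  σ′-τb = cong ι succ-τb

  σ′-τd : σ′ (old (τ d)) ≡ y⁻
  σ′-τd = cong ι succ-τd

  Generic : Pos w → Set
  Generic k = Kept k × k ≢ a × k ≢ c × k ≢ τ d × k ≢ τ b

  nxt-kept : ∀ {k} → k ≢ a → k ≢ c → Kept (nxt k)
  nxt-kept {k} k≢a k≢c = k≢a ∘ prev≡ , k≢c ∘ prev≡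
    where
    prev≡ : ∀ {x} → nxt k ≡ x → k ≡ prev x
    prev≡ eq = trans (sym (prev-nxt k)) (cong prev eq)

  nxt-generic : ∀ {k} → Generic k → Kept (nxt k) × nxt k ≢ r × nxt k ≢ s
  nxt-generic {k} (_ , k≢a , k≢c , k≢τd , k≢τb) =
    nxt-kept k≢a k≢c , k≢τd ∘ nxt≡ nxt-τd , k≢τb ∘ nxt≡ nxt-τb
    where
    nxt≡ : ∀ {x y} → nxt x ≡ y → nxt k ≡ y → k ≡ x
    nxt≡ eq₁ eq₂ = nxt-injective (trans eq₂ (sym eq₁))

  σ′-generic : ∀ {k} → Generic k → σ′ (old k) ≡ old (σ k)
  σ′-generic g with kept , nk≢r , nk≢s ← nxt-generic g =
    cong ι (trans (succ-old kept) (entry-plain nk≢r nk≢s))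

  generic-σ : ∀ {k} → Generic k → Generic (σ k)
  generic-σ {k} ((k≢p , k≢q) , k≢a , k≢c , k≢τd , k≢τb) =
    ((λ eq → k≢c (trans (σ⁻¹ eq) σ-τb)) , (λ eq → k≢a (trans (σ⁻¹ eq) σ-τd))) ,
    (λ eq → k≢τd (trans (σ⁻¹ eq) (cong σ σ-a))) , (λ eq → k≢τb (trans (σ⁻¹ eq) (cong σ σ-c))) ,
    (λ eq → k≢q (trans (σ⁻¹ eq) (trans (cong σ σ-τd) σ-a))) ,
    (λ eq → k≢p (trans (σ⁻¹ eq) (trans (cong σ σ-τb) σ-c)))
    where
    σ⁻¹ : ∀ {x} → σ k ≡ x → k ≡ σ (σ x)
    σ⁻¹ eq = trans (sym (σ³ k)) (cong (σ ∘ σ) eq)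

  -- The move replaces the vertices {a, q, τ d} and {c, p, τ b} of w by
  -- {a, τ b, y⁺} and {c, τ d, y⁻}; all other vertices are unchanged.
  σ′³ : ∀ {x} → Valid x → σ′ (σ′ (σ′ x)) ≡ x
  σ′³ {y⁺} _ = three-cycle σ′-y⁺ σ′-a σ′-τb
  σ′³ {y⁻} _ = three-cycle σ′-y⁻ σ′-c σ′-τd
  σ′³ {old k} kept with k ≟ a | k ≟ c | k ≟ τ d | k ≟ τ b
  ... | yes refl | _        | _        | _        = three-cycle σ′-a σ′-τb σ′-y⁺
  ... | no _     | yes refl | _        | _        = three-cycle σ′-c σ′-τd σ′-y⁻
  ... | no _     | no _     | yes refl | _        = three-cycle σ′-τd σ′-y⁻ σ′-c
  ... | no _     | no _     | no _     | yes refl = three-cycle σ′-τb σ′-y⁺ σ′-a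
  ... | no k≢a   | no k≢c   | no k≢τd  | no k≢τb  = three-cycle (σ′-generic g) (σ′-generic (generic-σ g))
    (trans (σ′-generic (generic-σ (generic-σ g))) (cong old (σ³ k)))
    where g = kept , k≢a , k≢c , k≢τd , k≢τb

  succ≢ι : ∀ {x} → Valid x → succ x ≢ ι x
  succ≢ι {y⁺} _ ()
  succ≢ι {y⁻} _ ()
  succ≢ι {old k} _ eq with k ≟ a | k ≟ c
  ... | yes refl | _        = b≢r (old-injective (trans (sym succ-a) eq))
  ... | no _     | yes refl = d≢s (old-injective (trans (sym succ-c) eq))
  ... | no k≢a   | no k≢c   with nxt k ≟ r | nxt k ≟ s
  ...   | yes nk≡r | _
    with () ← trans (sym (trans (cong entry nk≡r) entry-r)) (trans (sym (succ-old (nxt-kept k≢a k≢c))) eq)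
  ...   | no _     | yes nk≡s
    with () ← trans (sym (trans (cong entry nk≡s) entry-s)) (trans (sym (succ-old (nxt-kept k≢a k≢c))) eq)
  ...   | no nk≢r  | no nk≢s  =
    nxt≢τ k (old-injective (trans (sym (entry-plain nk≢r nk≢s)) (trans (sym (succ-old (nxt-kept k≢a k≢c))) eq)))

  module Labelled (y : Letter) (fresh : Fresh w y) where

    lab : Token → Letter
    lab (old i) = at w i
    lab y⁺      = y
    lab y⁻      = inv y

    lab-injective : ∀ {x x′} → lab x ≡ lab x′ → x ≡ x′
    lab-injective {old i} {old j} eq = cong old (at-injective eq)
    lab-injective {old i} {y⁺}    eq = ⊥-elim (fresh i (cong proj₁ eq))
    lab-injective {old i} {y⁻}    eq = ⊥-elim (fresh i (cong proj₁ eq))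
    lab-injective {y⁺}    {old j} eq = ⊥-elim (fresh j (cong proj₁ (sym eq)))
    lab-injective {y⁻}    {old j} eq = ⊥-elim (fresh j (cong proj₁ (sym eq)))
    lab-injective {y⁺}    {y⁺}    _  = refl
    lab-injective {y⁺}    {y⁻}    eq = ⊥-elim (inv≢ y (sym eq))
    lab-injective {y⁻}    {y⁺}    eq = ⊥-elim (inv≢ y eq)
    lab-injective {y⁻}    {y⁻}    _  = refl

    ι-lab : ∀ x → lab (ι x) ≡ inv (lab x)
    ι-lab (old i) = τ-at i
    ι-lab y⁺      = refl
    ι-lab y⁻      = sym (inv-involutive y)

    map-lab-tokens : map lab tokens ≡ edit w p q r y s (inv y)
    map-lab-tokens = trans (List.map-concatMap lab block (allFin (length w)))
                           (List.concatMap-cong map-lab-block (allFin (length w)))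
      where
      map-lab-block : ∀ i → map lab (block i) ≡
        (if does (i ≟ p) then [] else if does (i ≟ q) then []
         else if does (i ≟ r) then y ∷ at w i ∷ [] else if does (i ≟ s) then inv y ∷ at w i ∷ []
         else at w i ∷ [])
      map-lab-block i with does (i ≟ p)
      ... | true  = refl
      ... | false with does (i ≟ q)
      ...   | true  = refl
      ...   | false with does (i ≟ r)
      ...     | true  = refl
      ...     | false with does (i ≟ s)
      ...       | true  = refl
      ...       | false = refl

    transformed-trivalentWicks : ∀ {w′} → Rotation w′ (edit w p q r y s (inv y)) →
                              TrivalentWicks w′ × length w′ ≡ length w
    transformed-trivalentWicks {w′} (k , w′≡) = subst TrivalentWicks (sym w′≡map) word , length≡
      where
      L : List Token
      L = drop k tokens ++ take k tokens
      L↭tokens : L ↭ tokens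
      L↭tokens = ↭-trans (++-comm (drop k tokens) (take k tokens)) (↭-reflexive (List.take++drop≡id k tokens))
      ∈L⇔ : ∀ x → x ∈ L ⇔ Valid x
      ∈L⇔ x = mk⇔ (to (∈-tokens⇔ x) ∘ ∈-resp-↭ L↭tokens)
                  (∈-resp-↭ (↭-sym L↭tokens) ∘ from (∈-tokens⇔ x))
      w′≡map : w′ ≡ map lab L
      w′≡map = begin
        w′
          ≡⟨ w′≡ ⟩
        drop k (edit w p q r y s (inv y)) ++ take k (edit w p q r y s (inv y))
          ≡⟨ cong (λ e → drop k e ++ take k e) map-lab-tokens ⟨
        drop k (map lab tokens) ++ take k (map lab tokens)
          ≡⟨ cong₂ _++_ (List.drop-map k tokens) (List.take-map k tokens) ⟩
        map lab (drop k tokens) ++ map lab (take k tokens)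
          ≡⟨ List.map-++ lab (drop k tokens) (take k tokens) ⟨
        map lab L ∎
        where open ≡-Reasoning
      open TokenWord lab lab-injective ι ι-lab succ
        (Permutationₛ.Unique-resp-↭ (setoid Token) (↭⇒↭ₛ (↭-sym L↭tokens)) tokens-unique)
        (cycle-rotate k tokens-cycle)
        (λ x∈L → from (∈L⇔ _) (ι-valid (to (∈L⇔ _) x∈L)))
      word : TrivalentWicks (map lab L)
      word = trivalentWicks (succ≢ι ∘ to (∈L⇔ _)) (σ′³ ∘ to (∈L⇔ _))
      length≡ : length w′ ≡ length w
      length≡ = begin
        length w′              ≡⟨ cong length w′≡map ⟩
        length (map lab L)     ≡⟨ List.length-map lab L ⟩
        length L               ≡⟨ ↭-length L↭tokens ⟩
        length tokens          ≡⟨ length-tokens ⟩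
        length w               ∎
        where open ≡-Reasoning

edit-swap : ∀ w p q r l₁ s l₂ → r ≢ s → edit w p q r l₁ s l₂ ≡ edit w p q s l₂ r l₁
edit-swap w p q r l₁ s l₂ r≢s = List.concatMap-cong swap (allFin (length w))
  where
  swap : ∀ i → (if does (i ≟ p) then [] else if does (i ≟ q) then []
                else if does (i ≟ r) then l₁ ∷ at w i ∷ [] else if does (i ≟ s) then l₂ ∷ at w i ∷ []
                else at w i ∷ [])
             ≡ (if does (i ≟ p) then [] else if does (i ≟ q) then []
                else if does (i ≟ s) then l₂ ∷ at w i ∷ [] else if does (i ≟ r) then l₁ ∷ at w i ∷ []
                else at w i ∷ [])
  swap i with does (i ≟ p)
  ... | true  = refl
  ... | false with does (i ≟ q)
  ...   | true  = refl
  ...   | false with i ≟ r | i ≟ s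
  ...     | yes refl | yes refl = ⊥-elim (r≢s refl)
  ...     | yes _    | no _     = refl
  ...     | no _     | yes _    = refl
  ...     | no _     | no _     = refl

module _ {w : List Letter} (c1 : Cond1 w) (c2 : Cond2 w) where

  open Corners w c1 c2

  -- All three types insert the new letter before the inverses of a and c
  -- (type 2a after renaming y to y⁻¹).
  Move : List Letter → Set
  Move w′ = Σ (Pos w) λ p → Σ Letter λ y →
    Fresh w y × Rotation w′ (edit w p (τ p) (τ (prev p)) y (τ (prev (τ p))) (inv y))

  IH⇒Move : ∀ {w′} → IH w w′ → Move w′
  IH⇒Move (p , q , y , q-at , fresh , inj₁ (_ , _ , r , s , r-at , s-at , rotation))
    with refl ← τ-unique p q-at | refl ← τ-unique (prev p) r-at | refl ← τ-unique (prev q) s-at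
    = p , y , fresh , rotation
  IH⇒Move (p , q , y , q-at , fresh , inj₂ (inj₂ (_ , r , s , r-at , s-at , rotation)))
    with refl ← τ-unique p q-at | refl ← τ-unique (prev p) r-at | refl ← τ-unique (prev q) s-at
    = p , y , fresh , rotation
  IH⇒Move (p , q , y , q-at , fresh , inj₂ (inj₁ (c-at , k , rotation)))
    with refl ← τ-unique p q-at
    = p , inv y , fresh , k , trans rotation (cong (λ e → drop k e ++ take k e) swapped)
    where
    a≡τc : prev p ≡ τ (prev (τ p))
    a≡τc = trans (sym (τ-involutive (prev p))) (cong τ (sym (τ-unique (prev p) c-at)))
    swapped : edit w p (τ p) (prev p) y (prev (τ p)) (inv y)
            ≡ edit w p (τ p) (τ (prev p)) (inv y) (τ (prev (τ p))) (inv (inv y))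
    swapped = begin
      edit w p (τ p) (prev p) y (prev (τ p)) (inv y)
        ≡⟨ edit-swap w p (τ p) (prev p) y (prev (τ p)) (inv y) (τ≢ p ∘ sym ∘ prev-injective) ⟩
      edit w p (τ p) (prev (τ p)) (inv y) (prev p) y
        ≡⟨ cong₂ (λ r s → edit w p (τ p) r (inv y) s y) (τ-unique (prev p) c-at) a≡τc ⟩
      edit w p (τ p) (τ (prev p)) (inv y) (τ (prev (τ p))) y
        ≡⟨ cong (edit w p (τ p) (τ (prev p)) (inv y) (τ (prev (τ p)))) (inv-involutive y) ⟨
      edit w p (τ p) (τ (prev p)) (inv y) (τ (prev (τ p))) (inv (inv y)) ∎
      where open ≡-Reasoning

same-length⇒same-sign-counts :
  ∀ {u u′} → TrivalentWicks u → TrivalentWicks u′ → Pos u → length u′ ≡ length u →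
  (∀ m → NumPositive u m ⇔ NumPositive u′ m) × (∀ m → NumNegative u m ⇔ NumNegative u′ m)
same-length⇒same-sign-counts {u} {u′} t t′ p len =
  (λ m → via (U.numPositive⇔ p m) (U′.numPositive⇔ p′ m) (cong (6 * m + 6 ≡_) (sym len))) ,
  (λ m → via (U.numNegative⇔ p m) (U′.numNegative⇔ p′ m) (cong (λ n → 6 * m ≡ n + 6) (sym len)))
  where
  open TrivalentWicks
  module U  = Corners.OfTrivalent u  (cond1 t)  (cond2 t)  (trivalent t)
  module U′ = Corners.OfTrivalent u′ (cond1 t′) (cond2 t′) (trivalent t′)
  p′ : Pos u′
  p′ = cast (sym len) p
  via : ∀ {A B C D : Set} → A ⇔ C → B ⇔ D → C ≡ D → A ⇔ B
  via A⇔C B⇔D refl = mk⇔ (from B⇔D ∘ to A⇔C) (from A⇔C ∘ to B⇔D)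

lemma2p3 : (w w' : List Letter) → OrientedWicks w → Maximal w → IH w w' →
           (∀ m → NumPositive w m ⇔ NumPositive w' m)
         × (∀ m → NumNegative w m ⇔ NumNegative w' m)
lemma2p3 w w′ (c1 , c2 , c3) maximal ih with IH⇒Move {w} c1 c2 ih
... | p , y , fresh , rotation =
  same-length⇒same-sign-counts wicks (proj₁ transformed) p (proj₂ transformed)
  where
  σ³ : Corners.Trivalent w c1 c2
  σ³ = Corners.maximal⇒trivalent w c1 c2 c3 maximal p
  wicks : TrivalentWicks w
  wicks = record { cond1 = c1 ; cond2 = c2 ; trivalent = σ³ }
  transformed : TrivalentWicks w′ × length w′ ≡ length w
  transformed = IHTransformation.Labelled.transformed-trivalentWicks {w} c1 c2 σ³ p y fresh rotation
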